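{- Let $V$ be a $\mathbb{Q}$-vector space of dimension $n\ge1$ and let $a_0,\dots,a_n$ be $n+1$ nonzero linear forms on $V$ which generate $V^\vee$. For $0\le j\le n$ put $\varepsilon_j=(-1)^j\,\mathrm{sign}\det(a_0,\dots,\widehat{a_j},\dots,a_n)\in\{ -1,0,1\}$. (i) If there are $\lambda_0>0,\dots,\lambda_n>0$ with $\sum_{j=0}^n\lambda_ja_j=0$, then all $\varepsilon_j$ are equal to a common sign $\varepsilon$ and $$\sum_{j=0}^n\varepsilon_j\,c^\vee(a_0,\dots,\widehat{a_j},\dots,a_n)\equiv\varepsilon\,\delta\mod\mathcal{L}(V).$$ (ii) If there is a relation $\sum_{j=0}^n\lambda_ja_j=0$ with at least one positive and at least one negative coefficient among $\lambda_0,\dots,\lambda_n$, then $$\sum_{j=0}^n\varepsilon_j\,c^\vee(a_0,\dots,\widehat{a_j},\dots,a_n)\equiv0\mod\mathcal{L}(V).$$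
   Context: $V^\vee$ is the dual $\mathbb{Q}$-vector space; $\det$ is a fixed nonzero alternating $n$-form on $V^\vee$ (orientation). $\widehat{a_j}$ means omitted. For linear forms $b_1,\dots,b_m$ on $V$, $c^\vee(b_1,\dots,b_m)$ is the indicator function of $\{v\in V: b_i(v)\ge0\ \forall i\}$. A polyhedral cone in $V$ is a set $\mathbb{Q}_{\ge0}v_1+\dots+\mathbb{Q}_{\ge0}v_p+\mathbb{Q}_{>0}v'_1+\dots+\mathbb{Q}_{>0}v'_q$ with nonzero $v_i,v'_j$ (possibly $p=q=0$, giving $\{0\}$). $\mathcal{K}(V)$ is the $\mathbb{Q}$-algebra of $\mathbb{Q}$-valued functions on $V$ generated by indicator functions of polyhedral cones, and $\mathcal{L}(V)\subset\mathcal{K}(V)$ is the $\mathbb{Q}$-subspace spanned by indicator functions of closed polyhedral cones containing a line $\mathbb{Q}v$ for some $v\ne0$. $\delta$ is the indicator function of $\{0\}$. -}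

module Defs where

open import Data.Nat using (ℕ; zero; suc)
open import Data.Fin using (Fin; zero; suc; punchIn; toℕ)
open import Data.Rational using (ℚ; 0ℚ; 1ℚ; _+_; _*_; -_; _-_; _≤_; _<_)
open import Data.Rational.Properties using (_≟_; _≤?_; _<?_)
open import Data.Product using (Σ; ∃; _×_; _,_)
open import Data.Sum using (_⊎_)
open import Relation.Nullary using (¬_; yes; no)
open import Relation.Binary.PropositionalEquality using (_≡_)

-- V = ℚ^n (every n-dimensional ℚ-space is isomorphic to it).
-- A linear form on ℚ^n is represented by its coefficient vector b, acting by b · v.
Vecℚ : ℕ → Set
Vecℚ n = Fin n → ℚ

∑ : ∀ {n} → (Fin n → ℚ) → ℚ
∑ {zero} f = 0ℚ
∑ {suc n} f = f zero + ∑ (λ i → f (suc i))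

_·_ : ∀ {n} → Vecℚ n → Vecℚ n → ℚ
b · v = ∑ (λ i → b i * v i)

IsZero : ∀ {n} → Vecℚ n → Set
IsZero v = ∀ i → v i ≡ 0ℚ

negPow : ℕ → ℚ
negPow zero = 1ℚ
negPow (suc k) = - negPow k

det : ∀ {n} → (Fin n → Fin n → ℚ) → ℚ
det {zero} M = 1ℚ
det {suc n} M = ∑ (λ k → negPow (toℕ k) * M zero k * det (λ i l → M (suc i) (punchIn k l)))

sign : ℚ → ℚ
sign q with 0ℚ <? q
... | yes _ = 1ℚ
... | no _ with q <? 0ℚ
...   | yes _ = - 1ℚ
...   | no _ = 0ℚ

omit : ∀ {n} {A : Set} → Fin (suc n) → (Fin (suc n) → A) → Fin n → A
omit j a i = a (punchIn j i)

-- The orientation: every nonzero alternating n-form on (ℚ^n)^∨ is c · det for some c ≠ 0.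
-- ε_j = (-1)^j sign (c · det(a_0,…,â_j,…,a_n))
epsilon : ∀ {n} → ℚ → (Fin (suc n) → Vecℚ n) → Fin (suc n) → ℚ
epsilon c a j = negPow (toℕ j) * sign (c * det (omit j a))

cdual : ∀ {n m} → (Fin m → Vecℚ n) → Vecℚ n → ℚ
cdual {m = zero} b v = 1ℚ
cdual {m = suc m} b v with 0ℚ ≤? (b zero · v)
... | yes _ = cdual (λ i → b (suc i)) v
... | no _ = 0ℚ

delta : ∀ {n} → Vecℚ n → ℚ
delta {zero} v = 1ℚ
delta {suc n} v with v zero ≟ 0ℚ
... | yes _ = delta (λ i → v (suc i))
... | no _ = 0ℚ

InCone : ∀ {n p} → (Fin p → Vecℚ n) → Vecℚ n → Set
InCone {n} {p} g x =
  Σ (Fin p → ℚ) (λ t → (∀ i → 0ℚ ≤ t i) × (∀ k → x k ≡ ∑ (λ i → t i * g i k)))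

record LineCone (n : ℕ) : Set where
  field
    p : ℕ
    gens : Fin p → Vecℚ n
    gensNonzero : ∀ i → ¬ IsZero (gens i)
    line : Vecℚ n
    lineNonzero : ¬ IsZero line
    lineInCone : ∀ (s : ℚ) → InCone gens (λ k → s * line k)

IndVal : ∀ {n} → LineCone n → Vecℚ n → ℚ → Set
IndVal C x r = (InCone (LineCone.gens C) x × r ≡ 1ℚ) ⊎ (¬ InCone (LineCone.gens C) x × r ≡ 0ℚ)

-- f ∈ 𝓛(V): f is a finite ℚ-linear combination of indicators of such cones
InL : ∀ {n} → (Vecℚ n → ℚ) → Set
InL {n} f =
  Σ ℕ (λ m → Σ (Fin m → ℚ) (λ coeff → Σ (Fin m → LineCone n) (λ C →
    ∀ x → Σ (Fin m → ℚ) (λ r → (∀ k → IndVal (C k) x (r k)) × (f x ≡ ∑ (λ k → coeff k * r k))))))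

_≡_modL : ∀ {n} → (Vecℚ n → ℚ) → (Vecℚ n → ℚ) → Set
f ≡ g modL = InL (λ x → f x - g x)

coneSum : ∀ {n} → ℚ → (Fin (suc n) → Vecℚ n) → Vecℚ n → ℚ
coneSum c a v = ∑ (λ j → epsilon c a j * cdual (omit j a) v)

Generates : ∀ {n} → (Fin (suc n) → Vecℚ n) → Set
Generates {n} a = ∀ (w : Vecℚ n) → Σ (Fin (suc n) → ℚ) (λ μ → ∀ k → w k ≡ ∑ (λ j → μ j * a j k))

IsRelation : ∀ {n} → (Fin (suc n) → Vecℚ n) → (Fin (suc n) → ℚ) → Set
IsRelation a lam = ∀ k → ∑ (λ j → lam j * a j k) ≡ 0ℚ

module Submission where

-- By Cramer's rule the signed cofactors (-1)^j det(a_0,…,â_j,…,a_n) are proportional to any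
-- relation λ, so ε_j = sign(λ_j) · s for a single sign s; when s ≠ 0 every cofactor with λ_j ≠ 0 is
-- nonzero, and everything reduces to the congruence
--   ∑_{λ_j > 0} c^∨(a_0,…,â_j,…,a_n) ≡ c^∨(a_0,…,a_n)  mod 𝓛(V)
-- for relations λ with some λ_j > 0.  The function ∏_i (𝟙[a_i(x) ≥ 0] − [λ_i > 0]) vanishes: if no
-- factor vanished at x, then λ_i a_i(x) ≤ 0 for all i, strictly where λ_i > 0, contradicting
-- ∑ λ_i a_i = 0.  Expanding the product over the subsets T of kept indices, T = all gives
-- c^∨(a_0,…,a_n) and T = all but j gives −[λ_j > 0] c^∨(a_0,…,â_j,…,a_n).  A T missing two indices
-- j ≠ k contributes nothing unless λ_j, λ_k > 0, and then the dual cone of the a_i, i ∈ T, contains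
-- a line: the a_i with i ≠ j form a basis, and the vector of the dual basis belonging to a_k is
-- killed by every a_i, i ∈ T.  Part (i) follows because c^∨(a_0,…,a_n) = δ for a positive relation,
-- part (ii) by subtracting the congruences for λ and −λ.

open import Defs

open import Algebra.Bundles using (CommutativeMonoid; CommutativeRing)
import Algebra.Properties.CommutativeSemigroup as CommutativeSemigroupProperties
import Algebra.Properties.CommutativeMonoid.Sum as MonoidSum
import Algebra.Properties.Semiring.Sum as SemiringSum
open import Data.Bool.Base using (Bool; if_then_else_)
import Data.Bool.Properties as Bool
open import Data.Empty using (⊥-elim)
open import Data.Fin.Base using (Fin; zero; suc; punchIn; punchOut; toℕ; _↑ˡ_; _↑ʳ_; splitAt)
import Data.Fin.Properties as Fin
open import Data.Fin.Properties using (suc-injective; punchInᵢ≢i; punchOut-cong; punchOut-punchIn; punchIn-punchOut; punchOut-injective; any?; all?; ¬∀⟶∃¬)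
open import Data.Fin.Subset using (Subset; inside; outside; ⊤; ∁; ∣_∣)
open import Data.Nat.Base as ℕ using (ℕ; zero; suc)
open import Data.Nat.Properties as ℕP using ()
open import Data.Product.Base using (Σ; ∃; _×_; _,_; proj₁; proj₂)
open import Data.Rational.Base using (ℚ; 0ℚ; 1ℚ; ½; _+_; _*_; -_; _-_; _≤_; _<_; 1/_; NonZero; ≢-nonZero; positive; negative; nonNegative; nonPositive)
open import Data.Rational.Properties as ℚP using (_≟_; _≤?_; _<?_)
open import Algebra.Properties.Group ℚP.+-0-group
  using () renaming (⁻¹-involutive to neg-involutive; inverseʳ-unique to +-inverseʳ-unique; x∙y⁻¹≈ε⇒x≈y to x-y≡0⇒x≡y)
open import Data.Sum.Base using (_⊎_; inj₁; inj₂)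
open import Data.Vec.Base using ([]; _∷_; lookup; _[_]≔_)
open import Data.Vec.Properties using (lookup-replicate; lookup∘update; lookup∘update′)
open import Data.Vec.Functional using (_++_; updateAt)
open import Data.Vec.Functional.Properties using (lookup-++ˡ; lookup-++ʳ; updateAt-updates; updateAt-minimal; updateAt-commutes)
open import Function.Base using (_∘_; const)
open import Level using (0ℓ)
open import Relation.Binary.PropositionalEquality
open import Relation.Binary.Definitions using (tri<; tri≈; tri>)
open import Relation.Nullary using (¬_; Dec; yes; no; does)
open import Relation.Nullary.Decidable using (dec-true; dec-false; dec⇒maybe; _→-dec_; _×-dec_; ¬?)
open import Tactic.RingSolver using (solve-∀)
open import Tactic.RingSolver.Core.AlmostCommutativeRing using (AlmostCommutativeRing; fromCommutativeRing)
open ≡-Reasoning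

ℚ-ring : AlmostCommutativeRing 0ℓ 0ℓ
ℚ-ring = fromCommutativeRing ℚP.+-*-commutativeRing (λ x → dec⇒maybe (0ℚ ≟ x))

module Σℚ = SemiringSum (CommutativeRing.semiring ℚP.+-*-commutativeRing)
module Πℚ = MonoidSum ℚP.*-1-commutativeMonoid
open Πℚ using () renaming (sum to ∏)
module +-ℚ = CommutativeSemigroupProperties (CommutativeMonoid.commutativeSemigroup ℚP.+-0-commutativeMonoid)
module *-ℚ = CommutativeSemigroupProperties (CommutativeMonoid.commutativeSemigroup ℚP.*-1-commutativeMonoid)

𝟙 : ∀ {p} {P : Set p} → Dec P → ℚ
𝟙 d = if does d then 1ℚ else 0ℚ

𝟙-yes : ∀ {p} {P : Set p} (d : Dec P) → P → 𝟙 d ≡ 1ℚ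
𝟙-yes d p = cong (if_then 1ℚ else 0ℚ) (dec-true d p)

𝟙-no : ∀ {p} {P : Set p} (d : Dec P) → ¬ P → 𝟙 d ≡ 0ℚ
𝟙-no d ¬p = cong (if_then 1ℚ else 0ℚ) (dec-false d ¬p)

0≤1 : 0ℚ ≤ 1ℚ
0≤1 = ℚP.<⇒≤ (ℚP.positive⁻¹ 1ℚ)

𝟙-nonneg : ∀ {p} {P : Set p} (d : Dec P) → 0ℚ ≤ 𝟙 d
𝟙-nonneg (yes _) = 0≤1
𝟙-nonneg (no _) = ℚP.≤-refl

pos⇒≢0 : ∀ {x} → 0ℚ < x → x ≢ 0ℚ
pos⇒≢0 0<x = ≢-sym (ℚP.<⇒≢ 0<x)

*-nonneg : ∀ {x y} → 0ℚ ≤ x → 0ℚ ≤ y → 0ℚ ≤ x * y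
*-nonneg {x} {y} 0≤x 0≤y =
  ℚP.nonNegative⁻¹ (x * y) {{ℚP.nonNeg*nonNeg⇒nonNeg x {{nonNegative 0≤x}} y {{nonNegative 0≤y}}}}

*-nonpos-nonneg : ∀ {x y} → x ≤ 0ℚ → 0ℚ ≤ y → x * y ≤ 0ℚ
*-nonpos-nonneg {x} {y} x≤0 0≤y =
  ℚP.nonPositive⁻¹ (x * y) {{ℚP.nonPos*nonNeg⇒nonPos x {{nonPositive x≤0}} y {{nonNegative 0≤y}}}}

*-pos-neg : ∀ {x y} → 0ℚ < x → y < 0ℚ → x * y < 0ℚ
*-pos-neg {x} {y} 0<x y<0 = subst (x * y <_) (ℚP.*-zeroʳ x) (ℚP.*-monoʳ-<-pos x {{positive 0<x}} y<0)

*-pos-pos : ∀ {x y} → 0ℚ < x → 0ℚ < y → 0ℚ < x * y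
*-pos-pos {x} {y} 0<x 0<y = subst (_< x * y) (ℚP.*-zeroʳ x) (ℚP.*-monoʳ-<-pos x {{positive 0<x}} 0<y)

*-neg-neg : ∀ {x y} → x < 0ℚ → y < 0ℚ → 0ℚ < x * y
*-neg-neg {x} {y} x<0 y<0 = subst (_< x * y) (ℚP.*-zeroʳ x) (ℚP.*-monoʳ-<-neg x {{negative x<0}} y<0)

x*y≡0⇒y≡0 : ∀ {x y} → x ≢ 0ℚ → x * y ≡ 0ℚ → y ≡ 0ℚ
x*y≡0⇒y≡0 {x} {y} x≢0 x*y≡0 = begin
  y                ≡⟨ ℚP.*-identityˡ y ⟨
  1ℚ * y           ≡⟨ cong (_* y) (ℚP.*-inverseˡ x) ⟨
  1/ x * x * y     ≡⟨ ℚP.*-assoc (1/ x) x y ⟩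
  1/ x * (x * y)   ≡⟨ cong (1/ x *_) x*y≡0 ⟩
  1/ x * 0ℚ        ≡⟨ ℚP.*-zeroʳ (1/ x) ⟩
  0ℚ               ∎
  where
  instance
    x-nonZero : NonZero x
    x-nonZero = ≢-nonZero x≢0

∑≡sum : ∀ {n} (f : Fin n → ℚ) → ∑ f ≡ Σℚ.sum f
∑≡sum {zero} f = refl
∑≡sum {suc n} f = cong (f zero +_) (∑≡sum (f ∘ suc))

∑-cong : ∀ {n} {f g : Fin n → ℚ} → (∀ i → f i ≡ g i) → ∑ f ≡ ∑ g
∑-cong {zero} f≗g = refl
∑-cong {suc n} f≗g = cong₂ _+_ (f≗g zero) (∑-cong (f≗g ∘ suc))

∑-distrib-+ : ∀ {n} (f g : Fin n → ℚ) → ∑ (λ i → f i + g i) ≡ ∑ f + ∑ g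
∑-distrib-+ f g rewrite ∑≡sum (λ i → f i + g i) | ∑≡sum f | ∑≡sum g = Σℚ.∑-distrib-+ f g

*-distribˡ-∑ : ∀ {n} (c : ℚ) (f : Fin n → ℚ) → c * ∑ f ≡ ∑ (λ i → c * f i)
*-distribˡ-∑ c f rewrite ∑≡sum f | ∑≡sum (λ i → c * f i) = Σℚ.*-distribˡ-sum c f

*-distribʳ-∑ : ∀ {n} (c : ℚ) (f : Fin n → ℚ) → ∑ f * c ≡ ∑ (λ i → f i * c)
*-distribʳ-∑ c f rewrite ∑≡sum f | ∑≡sum (λ i → f i * c) = Σℚ.*-distribʳ-sum c f

∑-remove : ∀ {n} (i : Fin (suc n)) (f : Fin (suc n) → ℚ) → ∑ f ≡ f i + ∑ (f ∘ punchIn i)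
∑-remove i f rewrite ∑≡sum f | ∑≡sum (f ∘ punchIn i) = Σℚ.sum-remove f

∑-comm : ∀ {m n} (f : Fin m → Fin n → ℚ) → ∑ (λ i → ∑ (f i)) ≡ ∑ (λ j → ∑ (λ i → f i j))
∑-comm {m} {n} f = begin
  ∑ (λ i → ∑ (f i))                   ≡⟨ ∑≡sum (λ i → ∑ (f i)) ⟩
  Σℚ.sum (λ i → ∑ (f i))              ≡⟨ Σℚ.sum-cong-≗ (∑≡sum ∘ f) ⟩
  Σℚ.sum (λ i → Σℚ.sum (f i))         ≡⟨ Σℚ.∑-comm f ⟩
  Σℚ.sum (λ j → Σℚ.sum (λ i → f i j)) ≡⟨ Σℚ.sum-cong-≗ (λ j → ∑≡sum (λ i → f i j)) ⟨
  Σℚ.sum (λ j → ∑ (λ i → f i j))      ≡⟨ ∑≡sum (λ j → ∑ (λ i → f i j)) ⟨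
  ∑ (λ j → ∑ (λ i → f i j))           ∎

∑-zero : ∀ {n} (f : Fin n → ℚ) → (∀ i → f i ≡ 0ℚ) → ∑ f ≡ 0ℚ
∑-zero {n} f f≗0 = trans (trans (∑-cong f≗0) (∑≡sum {n} (const 0ℚ))) (Σℚ.sum-replicate-zero n)

neg-distrib-∑ : ∀ {n} (f : Fin n → ℚ) → - ∑ f ≡ ∑ (λ i → - f i)
neg-distrib-∑ {zero} f = refl
neg-distrib-∑ {suc n} f = trans (ℚP.neg-distrib-+ (f zero) _) (cong (- f zero +_) (neg-distrib-∑ (f ∘ suc)))

∑-single : ∀ {n} (k : Fin n) (f : Fin n → ℚ) → (∀ i → i ≢ k → f i ≡ 0ℚ) → ∑ f ≡ f k
∑-single {suc n} k f f≗0 = begin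
  ∑ f                          ≡⟨ ∑-remove k f ⟩
  f k + ∑ (f ∘ punchIn k)      ≡⟨ cong (f k +_) (∑-zero _ (λ l → f≗0 (punchIn k l) (punchInᵢ≢i k l))) ⟩
  f k + 0ℚ                     ≡⟨ ℚP.+-identityʳ (f k) ⟩
  f k                          ∎

∑-linear : ∀ {n} (α : ℚ) (t f g : Fin n → ℚ) → (∀ k → t k ≡ α * f k + g k) → ∑ t ≡ α * ∑ f + ∑ g
∑-linear α t f g t≗αf+g = begin
  ∑ t                               ≡⟨ ∑-cong t≗αf+g ⟩
  ∑ (λ k → α * f k + g k)           ≡⟨ ∑-distrib-+ (λ k → α * f k) g ⟩
  ∑ (λ k → α * f k) + ∑ g           ≡⟨ cong (_+ ∑ g) (*-distribˡ-∑ α f) ⟨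
  α * ∑ f + ∑ g                     ∎

∑-↑ : ∀ {m n} (f : Fin (m ℕ.+ n) → ℚ) → ∑ f ≡ ∑ (λ i → f (i ↑ˡ n)) + ∑ (λ i → f (m ↑ʳ i))
∑-↑ {zero} f = sym (ℚP.+-identityˡ (∑ f))
∑-↑ {suc m} {n} f = trans (cong (f zero +_) (∑-↑ {m} (f ∘ suc)))
  (sym (ℚP.+-assoc (f zero) (∑ (λ i → f (suc (i ↑ˡ n)))) (∑ (λ i → f (suc (m ↑ʳ i))))))

∑-++ : ∀ {m n} (f : Fin m → ℚ) (g : Fin n → ℚ) → ∑ (f ++ g) ≡ ∑ f + ∑ g
∑-++ {m} f g = trans (∑-↑ {m} (f ++ g)) (cong₂ _+_ (∑-cong (lookup-++ˡ f g)) (∑-cong (lookup-++ʳ f g)))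

*-++ : ∀ {m n} (c r : Fin m → ℚ) (c′ r′ : Fin n → ℚ) k →
       (c ++ c′) k * (r ++ r′) k ≡ ((λ i → c i * r i) ++ (λ i → c′ i * r′ i)) k
*-++ {m} c r c′ r′ k with splitAt m k
... | inj₁ i = refl
... | inj₂ i = refl

∑-nonneg : ∀ {n} (f : Fin n → ℚ) → (∀ i → 0ℚ ≤ f i) → 0ℚ ≤ ∑ f
∑-nonneg {zero} f f≥0 = ℚP.≤-refl
∑-nonneg {suc n} f f≥0 = ℚP.+-mono-≤ (f≥0 zero) (∑-nonneg (f ∘ suc) (f≥0 ∘ suc))

∑-nonpos : ∀ {n} (f : Fin n → ℚ) → (∀ i → f i ≤ 0ℚ) → ∑ f ≤ 0ℚ
∑-nonpos {zero} f f≤0 = ℚP.≤-refl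
∑-nonpos {suc n} f f≤0 = ℚP.+-mono-≤ (f≤0 zero) (∑-nonpos (f ∘ suc) (f≤0 ∘ suc))

∑-neg : ∀ {n} (f : Fin (suc n) → ℚ) k → (∀ i → f i ≤ 0ℚ) → f k < 0ℚ → ∑ f < 0ℚ
∑-neg f k f≤0 fk<0 = subst (_< 0ℚ) (sym (∑-remove k f)) (ℚP.+-mono-<-≤ fk<0 (∑-nonpos (f ∘ punchIn k) (f≤0 ∘ punchIn k)))

∑-pos : ∀ {n} (f : Fin (suc n) → ℚ) k → (∀ i → 0ℚ ≤ f i) → 0ℚ < f k → 0ℚ < ∑ f
∑-pos f k f≥0 0<fk = subst (0ℚ <_) (sym (∑-remove k f)) (ℚP.+-mono-<-≤ 0<fk (∑-nonneg (f ∘ punchIn k) (f≥0 ∘ punchIn k)))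

∑∑-antisymmetric : ∀ {n} (g : Fin n → Fin n → ℚ) → (∀ c q → g c q ≡ - g q c) → ∑ (λ c → ∑ (g c)) ≡ 0ℚ
∑∑-antisymmetric g g-antisym = x≡-x⇒x≡0 (begin
  ∑ (λ c → ∑ (g c))              ≡⟨ ∑-comm g ⟩
  ∑ (λ q → ∑ (λ c → g c q))      ≡⟨ ∑-cong (λ q → ∑-cong (λ c → g-antisym c q)) ⟩
  ∑ (λ q → ∑ (λ c → - g q c))    ≡⟨ ∑-cong (λ q → neg-distrib-∑ (g q)) ⟨
  ∑ (λ q → - ∑ (g q))            ≡⟨ neg-distrib-∑ (λ q → ∑ (g q)) ⟨
  - ∑ (λ c → ∑ (g c))            ∎)
  where
  x≡-x⇒x≡0 : ∀ {x} → x ≡ - x → x ≡ 0ℚ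
  x≡-x⇒x≡0 {x} x≡-x = begin
    x             ≡⟨ halve x ⟩
    ½ * (x + x)   ≡⟨ cong (λ y → ½ * (x + y)) x≡-x ⟩
    ½ * (x + - x) ≡⟨ cong (½ *_) (ℚP.+-inverseʳ x) ⟩
    ½ * 0ℚ        ≡⟨ ℚP.*-zeroʳ ½ ⟩
    0ℚ            ∎
    where
    halve : ∀ y → y ≡ ½ * (y + y)
    halve = solve-∀ ℚ-ring

∏-zero : ∀ {n} (k : Fin n) (f : Fin n → ℚ) → f k ≡ 0ℚ → ∏ f ≡ 0ℚ
∏-zero {suc n} k f fk≡0 = begin
  ∏ f                      ≡⟨ Πℚ.sum-remove {i = k} f ⟩
  f k * ∏ (f ∘ punchIn k)  ≡⟨ cong (_* ∏ (f ∘ punchIn k)) fk≡0 ⟩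
  0ℚ * ∏ (f ∘ punchIn k)   ≡⟨ ℚP.*-zeroˡ (∏ (f ∘ punchIn k)) ⟩
  0ℚ                       ∎

∏-𝟙 : ∀ {m} {P : Fin m → Set} (P? : ∀ i → Dec (P i)) →
      ((∀ i → P i) × ∏ (λ i → 𝟙 (P? i)) ≡ 1ℚ) ⊎ (¬ (∀ i → P i) × ∏ (λ i → 𝟙 (P? i)) ≡ 0ℚ)
∏-𝟙 {m} {P} P? with all? P?
... | yes ∀P = inj₁ (∀P , trans (Πℚ.sum-cong-≗ (λ i → 𝟙-yes (P? i) (∀P i))) (Πℚ.sum-replicate-zero m))
... | no ¬∀P with ¬∀⟶∃¬ m P P? ¬∀P
...   | i , ¬Pi = inj₂ (¬∀P , ∏-zero i _ (𝟙-no (P? i) ¬Pi))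

∑ₛ : ∀ {m} → (Subset m → ℚ) → ℚ
∑ₛ {zero} F = F []
∑ₛ {suc m} F = ∑ₛ (F ∘ (outside ∷_)) + ∑ₛ (F ∘ (inside ∷_))

∑ₛ-cong : ∀ {m} {F G : Subset m → ℚ} → (∀ T → F T ≡ G T) → ∑ₛ F ≡ ∑ₛ G
∑ₛ-cong {zero} F≗G = F≗G []
∑ₛ-cong {suc m} F≗G = cong₂ _+_ (∑ₛ-cong (F≗G ∘ (outside ∷_))) (∑ₛ-cong (F≗G ∘ (inside ∷_)))

*-distribˡ-∑ₛ : ∀ {m} (c : ℚ) (F : Subset m → ℚ) → c * ∑ₛ F ≡ ∑ₛ (λ T → c * F T)
*-distribˡ-∑ₛ {zero} c F = refl
*-distribˡ-∑ₛ {suc m} c F = trans (ℚP.*-distribˡ-+ c _ _)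
  (cong₂ _+_ (*-distribˡ-∑ₛ c (F ∘ (outside ∷_))) (*-distribˡ-∑ₛ c (F ∘ (inside ∷_))))

∑ₛ-∏ : ∀ {m} (φ : Fin m → Bool → ℚ) →
       ∑ₛ (λ T → ∏ (λ i → φ i (lookup T i))) ≡ ∏ (λ i → φ i outside + φ i inside)
∑ₛ-∏ {zero} φ = refl
∑ₛ-∏ {suc m} φ = begin
  ∑ₛ (λ T → φ zero outside * P T) + ∑ₛ (λ T → φ zero inside * P T)
    ≡⟨ cong₂ _+_ (*-distribˡ-∑ₛ (φ zero outside) P) (*-distribˡ-∑ₛ (φ zero inside) P) ⟨
  φ zero outside * ∑ₛ P + φ zero inside * ∑ₛ P
    ≡⟨ ℚP.*-distribʳ-+ (∑ₛ P) (φ zero outside) (φ zero inside) ⟨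
  (φ zero outside + φ zero inside) * ∑ₛ P
    ≡⟨ cong ((φ zero outside + φ zero inside) *_) (∑ₛ-∏ (φ ∘ suc)) ⟩
  (φ zero outside + φ zero inside) * ∏ (λ i → φ (suc i) outside + φ (suc i) inside)
    ∎
  where
  P : Subset m → ℚ
  P T = ∏ (λ i → φ (suc i) (lookup T i))

∑ₛ≥ : ∀ {m} → ℕ → (Subset m → ℚ) → ℚ
∑ₛ≥ k F = ∑ₛ (λ T → 𝟙 (k ℕP.≤? ∣ ∁ T ∣) * F T)

∑ₛ≡⊤+∑ₛ≥1 : ∀ {m} (F : Subset m → ℚ) → ∑ₛ F ≡ F ⊤ + ∑ₛ≥ 1 F
∑ₛ≡⊤+∑ₛ≥1 {zero} F = sym (trans (cong (F [] +_) (ℚP.*-zeroˡ (F []))) (ℚP.+-identityʳ (F [])))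
-- ∣ ∁ (outside ∷ T) ∣ is suc ∣ ∁ T ∣, so 𝟙 (suc k ≤? ∣ ∁ (outside ∷ T) ∣) computes to 𝟙 (k ≤? ∣ ∁ T ∣).
∑ₛ≡⊤+∑ₛ≥1 {suc m} F = begin
  ∑ₛ Fₒ + ∑ₛ Fᵢ                              ≡⟨ cong₂ _+_ (∑ₛ-cong (sym ∘ ℚP.*-identityˡ ∘ Fₒ)) (∑ₛ≡⊤+∑ₛ≥1 Fᵢ) ⟩
  ∑ₛ (λ T → 1ℚ * Fₒ T) + (Fᵢ ⊤ + ∑ₛ≥ 1 Fᵢ)  ≡⟨ +-ℚ.x∙yz≈y∙xz (∑ₛ (λ T → 1ℚ * Fₒ T)) (Fᵢ ⊤) (∑ₛ≥ 1 Fᵢ) ⟩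
  F ⊤ + ∑ₛ≥ 1 F                              ∎
  where
  Fₒ Fᵢ : Subset m → ℚ
  Fₒ = F ∘ (outside ∷_)
  Fᵢ = F ∘ (inside ∷_)

∑ₛ≥1≡∑-⊤-j+∑ₛ≥2 : ∀ {m} (F : Subset m → ℚ) → ∑ₛ≥ 1 F ≡ ∑ (λ j → F (⊤ [ j ]≔ outside)) + ∑ₛ≥ 2 F
∑ₛ≥1≡∑-⊤-j+∑ₛ≥2 {zero} F = sym (ℚP.+-identityˡ (0ℚ * F []))
∑ₛ≥1≡∑-⊤-j+∑ₛ≥2 {suc m} F = begin
  ∑ₛ (λ T → 1ℚ * Fₒ T) + ∑ₛ≥ 1 Fᵢ
    ≡⟨ cong₂ _+_ (∑ₛ-cong (ℚP.*-identityˡ ∘ Fₒ)) (∑ₛ≥1≡∑-⊤-j+∑ₛ≥2 Fᵢ) ⟩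
  ∑ₛ Fₒ + (∑ (λ j → Fᵢ (⊤ [ j ]≔ outside)) + ∑ₛ≥ 2 Fᵢ)
    ≡⟨ cong (_+ (∑ (λ j → Fᵢ (⊤ [ j ]≔ outside)) + ∑ₛ≥ 2 Fᵢ)) (∑ₛ≡⊤+∑ₛ≥1 Fₒ) ⟩
  (Fₒ ⊤ + ∑ₛ≥ 1 Fₒ) + (∑ (λ j → Fᵢ (⊤ [ j ]≔ outside)) + ∑ₛ≥ 2 Fᵢ)
    ≡⟨ +-ℚ.interchange (Fₒ ⊤) (∑ₛ≥ 1 Fₒ) (∑ (λ j → Fᵢ (⊤ [ j ]≔ outside))) (∑ₛ≥ 2 Fᵢ) ⟩
  ∑ (λ j → F (⊤ [ j ]≔ outside)) + ∑ₛ≥ 2 F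
    ∎
  where
  Fₒ Fᵢ : Subset m → ℚ
  Fₒ = F ∘ (outside ∷_)
  Fᵢ = F ∘ (inside ∷_)

outside-exists : ∀ {m} (T : Subset m) → 1 ℕ.≤ ∣ ∁ T ∣ → ∃ λ k → lookup T k ≡ outside
outside-exists (outside ∷ T) _ = zero , refl
outside-exists (inside ∷ T) 1≤∣∁T∣ with outside-exists T 1≤∣∁T∣
... | k , k∉T = suc k , k∉T

two-outside : ∀ {m} (T : Subset m) → 2 ℕ.≤ ∣ ∁ T ∣ →
              Σ (Fin m) λ j → Σ (Fin m) λ k → j ≢ k × lookup T j ≡ outside × lookup T k ≡ outside
two-outside (outside ∷ T) (ℕ.s≤s 1≤∣∁T∣) with outside-exists T 1≤∣∁T∣
... | k , k∉T = zero , suc k , (λ ()) , refl , k∉T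
two-outside (inside ∷ T) 2≤∣∁T∣ with two-outside T 2≤∣∁T∣
... | j , k , j≢k , j∉T , k∉T = suc j , suc k , j≢k ∘ suc-injective , j∉T , k∉T

InL-ext : ∀ {n} {f g : Vecℚ n → ℚ} → (∀ x → f x ≡ g x) → InL f → InL g
InL-ext f≗g (m , coeff , C , val) = m , coeff , C , λ x →
  let (r , ind , eq) = val x in r , ind , trans (sym (f≗g x)) eq

InL-zero : ∀ {n} → InL {n} (const 0ℚ)
InL-zero = 0 , (λ ()) , (λ ()) , λ x → (λ ()) , (λ ()) , refl

InL-indicator : ∀ {n} (C : LineCone n) (χ : Vecℚ n → ℚ) → (∀ x → IndVal C x (χ x)) → InL χ
InL-indicator C χ ind = 1 , const 1ℚ , const C , λ x → const (χ x) , const (ind x) , χ≡1*χ+0 (χ x)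
  where
  χ≡1*χ+0 : ∀ y → y ≡ 1ℚ * y + 0ℚ
  χ≡1*χ+0 = solve-∀ ℚ-ring

InL-scale : ∀ {n} {f : Vecℚ n → ℚ} (c : ℚ) → InL f → InL (λ x → c * f x)
InL-scale c (m , coeff , C , val) = m , (λ k → c * coeff k) , C , λ x →
  let (r , ind , eq) = val x in r , ind , (begin
    c * _                         ≡⟨ cong (c *_) eq ⟩
    c * ∑ (λ k → coeff k * r k)   ≡⟨ *-distribˡ-∑ c (λ k → coeff k * r k) ⟩
    ∑ (λ k → c * (coeff k * r k)) ≡⟨ ∑-cong (λ k → ℚP.*-assoc c (coeff k) (r k)) ⟨
    ∑ (λ k → c * coeff k * r k)   ∎)

InL-+ : ∀ {n} {f g : Vecℚ n → ℚ} → InL f → InL g → InL (λ x → f x + g x)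
InL-+ {f = f} {g} (m , c , C , val) (m′ , c′ , C′ , val′) = m ℕ.+ m′ , c ++ c′ , C ++ C′ , λ x →
  let (r , ind , eq) = val x ; (r′ , ind′ , eq′) = val′ x in
  r ++ r′ , ++-ind ind ind′ , (begin
    f x + g x                                                  ≡⟨ cong₂ _+_ eq eq′ ⟩
    ∑ (λ k → c k * r k) + ∑ (λ k → c′ k * r′ k)                ≡⟨ ∑-++ (λ k → c k * r k) (λ k → c′ k * r′ k) ⟨
    ∑ ((λ k → c k * r k) ++ (λ k → c′ k * r′ k))               ≡⟨ ∑-cong (*-++ c r c′ r′) ⟨
    ∑ (λ k → (c ++ c′) k * (r ++ r′) k)                        ∎)
  where
  ++-ind : ∀ {x r r′} → (∀ k → IndVal (C k) x (r k)) → (∀ k → IndVal (C′ k) x (r′ k)) →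
           ∀ k → IndVal ((C ++ C′) k) x ((r ++ r′) k)
  ++-ind ind ind′ k with splitAt m k
  ... | inj₁ i = ind i
  ... | inj₂ i = ind′ i

InL-scale-nonzero : ∀ {n} {f : Vecℚ n → ℚ} (c : ℚ) → (c ≢ 0ℚ → InL f) → InL (λ x → c * f x)
InL-scale-nonzero {f = f} c InL-f with c ≟ 0ℚ
... | yes refl = InL-ext (λ x → sym (ℚP.*-zeroˡ (f x))) InL-zero
... | no c≢0 = InL-scale c (InL-f c≢0)

InL-𝟙* : ∀ {n p} {P : Set p} {f : Vecℚ n → ℚ} (d : Dec P) → (P → InL f) → InL (λ x → 𝟙 d * f x)
InL-𝟙* {f = f} (yes p) InL-f = InL-ext (λ x → sym (ℚP.*-identityˡ (f x))) (InL-f p)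
InL-𝟙* {f = f} (no _) _ = InL-ext (λ x → sym (ℚP.*-zeroˡ (f x))) InL-zero

InL-∑ₛ : ∀ {m n} (h : Subset m → Vecℚ n → ℚ) → (∀ T → InL (h T)) → InL (λ x → ∑ₛ (λ T → h T x))
InL-∑ₛ {zero} h InL-h = InL-h []
InL-∑ₛ {suc m} h InL-h = InL-+ (InL-∑ₛ (h ∘ (outside ∷_)) (InL-h ∘ (outside ∷_)))
                               (InL-∑ₛ (h ∘ (inside ∷_)) (InL-h ∘ (inside ∷_)))

sgn : ∀ {n} → Fin n → ℚ
sgn k = negPow (toℕ k)

sgn²≡1 : ∀ {n} (k : Fin n) → sgn k * sgn k ≡ 1ℚ
sgn²≡1 k = negPow² (toℕ k)
  where
  negPow² : ∀ m → negPow m * negPow m ≡ 1ℚ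
  negPow² zero = refl
  negPow² (suc m) = trans (neg*neg (negPow m)) (negPow² m)
    where
    neg*neg : ∀ x → (- x) * (- x) ≡ x * x
    neg*neg = solve-∀ ℚ-ring

sgn-punchOut : ∀ {n} {c q : Fin (suc n)} (c≢q : c ≢ q) (q≢c : q ≢ c) →
               sgn c * sgn (punchOut c≢q) ≡ - (sgn q * sgn (punchOut q≢c))
sgn-punchOut {c = zero} {zero} c≢q q≢c = ⊥-elim (c≢q refl)
sgn-punchOut {suc n} {c = zero} {suc q} c≢q q≢c = lemma (sgn q)
  where
  lemma : ∀ x → 1ℚ * x ≡ - ((- x) * 1ℚ)
  lemma = solve-∀ ℚ-ring
sgn-punchOut {suc n} {c = suc c} {zero} c≢q q≢c = lemma (sgn c)
  where
  lemma : ∀ x → (- x) * 1ℚ ≡ - (1ℚ * x)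
  lemma = solve-∀ ℚ-ring
sgn-punchOut {suc n} {suc c} {suc q} c≢q q≢c = trans (lemma (sgn c) (sgn (punchOut (c≢q ∘ cong suc))))
  (trans (sgn-punchOut (c≢q ∘ cong suc) (q≢c ∘ cong suc)) (cong -_ (sym (lemma (sgn q) (sgn (punchOut (q≢c ∘ cong suc)))))))
  where
  lemma : ∀ x y → (- x) * (- y) ≡ x * y
  lemma = solve-∀ ℚ-ring

punchIn-punchOut-comm : ∀ {n} {c q : Fin (suc (suc n))} (c≢q : c ≢ q) (q≢c : q ≢ c) (m : Fin n) →
                        punchIn c (punchIn (punchOut c≢q) m) ≡ punchIn q (punchIn (punchOut q≢c) m)
punchIn-punchOut-comm {c = zero} {zero} c≢q q≢c m = ⊥-elim (c≢q refl)
punchIn-punchOut-comm {c = zero} {suc q} c≢q q≢c m = refl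
punchIn-punchOut-comm {c = suc c} {zero} c≢q q≢c m = refl
punchIn-punchOut-comm {suc n} {suc c} {suc q} c≢q q≢c zero = refl
punchIn-punchOut-comm {suc n} {suc c} {suc q} c≢q q≢c (suc m) =
  cong suc (punchIn-punchOut-comm (c≢q ∘ cong suc) (q≢c ∘ cong suc) m)

sign-pos : ∀ {q} → 0ℚ < q → sign q ≡ 1ℚ
sign-pos {q} 0<q with 0ℚ <? q
... | yes _ = refl
... | no 0≮q = ⊥-elim (0≮q 0<q)

sign-neg : ∀ {q} → q < 0ℚ → sign q ≡ - 1ℚ
sign-neg {q} q<0 with 0ℚ <? q
... | yes 0<q = ⊥-elim (ℚP.<-asym q<0 0<q)
... | no _ with q <? 0ℚ
...   | yes _ = refl
...   | no q≮0 = ⊥-elim (q≮0 q<0)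

sign≡𝟙-𝟙 : ∀ q → sign q ≡ 𝟙 (0ℚ <? q) - 𝟙 (0ℚ <? - q)
sign≡𝟙-𝟙 q with ℚP.<-cmp q 0ℚ
... | tri< q<0 _ _ = trans (sign-neg q<0)
  (sym (cong₂ _-_ (𝟙-no (0ℚ <? q) (ℚP.<-asym q<0)) (𝟙-yes (0ℚ <? - q) (ℚP.neg-antimono-< q<0))))
... | tri≈ _ refl _ = refl
... | tri> _ _ 0<q = trans (sign-pos 0<q)
  (sym (cong₂ _-_ (𝟙-yes (0ℚ <? q) 0<q) (𝟙-no (0ℚ <? - q) (ℚP.<-asym (ℚP.neg-antimono-< 0<q)))))

sign-* : ∀ x y → sign (x * y) ≡ sign x * sign y
sign-* x y with ℚP.<-cmp x 0ℚ | ℚP.<-cmp y 0ℚ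
... | tri≈ _ refl _ | _ = trans (cong sign (ℚP.*-zeroˡ y)) (sym (ℚP.*-zeroˡ (sign y)))
... | tri< _ _ _ | tri≈ _ refl _ = trans (cong sign (ℚP.*-zeroʳ x)) (sym (ℚP.*-zeroʳ (sign x)))
... | tri> _ _ _ | tri≈ _ refl _ = trans (cong sign (ℚP.*-zeroʳ x)) (sym (ℚP.*-zeroʳ (sign x)))
... | tri< x<0 _ _ | tri< y<0 _ _ = trans (sign-pos (*-neg-neg x<0 y<0)) (sym (cong₂ _*_ (sign-neg x<0) (sign-neg y<0)))
... | tri< x<0 _ _ | tri> _ _ 0<y = trans (sign-neg (subst (_< 0ℚ) (ℚP.*-comm y x) (*-pos-neg 0<y x<0)))
                                           (sym (cong₂ _*_ (sign-neg x<0) (sign-pos 0<y)))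
... | tri> _ _ 0<x | tri< y<0 _ _ = trans (sign-neg (*-pos-neg 0<x y<0)) (sym (cong₂ _*_ (sign-pos 0<x) (sign-neg y<0)))
... | tri> _ _ 0<x | tri> _ _ 0<y = trans (sign-pos (*-pos-pos 0<x 0<y)) (sym (cong₂ _*_ (sign-pos 0<x) (sign-pos 0<y)))

sign-sgn : ∀ {n} (k : Fin n) → sign (sgn k) ≡ sgn k
sign-sgn k = sign-negPow (toℕ k)
  where
  sign-negPow : ∀ m → sign (negPow m) ≡ negPow m
  sign-negPow zero = refl
  sign-negPow (suc zero) = refl
  sign-negPow (suc (suc m)) = trans (cong sign (neg-involutive (negPow m)))
                                    (trans (sign-negPow m) (sym (neg-involutive (negPow m))))

-- Determinants

Matrix : ℕ → Set
Matrix n = Fin n → Vecℚ n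

minor : ∀ {n} → Matrix (suc n) → Fin (suc n) → Matrix n
minor M k i l = M (suc i) (punchIn k l)

replaceRow : ∀ {n} → Matrix n → Fin n → Vecℚ n → Matrix n
replaceRow M r v = updateAt M r (const v)

replaceRow-≡ : ∀ {n} (M : Matrix n) r v → replaceRow M r v r ≡ v
replaceRow-≡ M r v = updateAt-updates r M

replaceRow-≢ : ∀ {n} (M : Matrix n) {r t} v → t ≢ r → replaceRow M r v t ≡ M t
replaceRow-≢ M {r} {t} v t≢r = updateAt-minimal t r M t≢r

det-cong : ∀ {n} {M N : Matrix n} → (∀ i k → M i k ≡ N i k) → det M ≡ det N
det-cong {zero} M≗N = refl
det-cong {suc n} M≗N = ∑-cong (λ k →
  cong₂ (λ x y → sgn k * x * y) (M≗N zero k) (det-cong (λ i l → M≗N (suc i) (punchIn k l))))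

det-linear : ∀ {n} (r : Fin n) (α : ℚ) (M N P : Matrix n) →
             (∀ i → i ≢ r → ∀ k → M i k ≡ P i k) → (∀ i → i ≢ r → ∀ k → N i k ≡ P i k) →
             (∀ k → P r k ≡ α * M r k + N r k) → det P ≡ α * det M + det N
det-linear {suc n} zero α M N P M≈P N≈P Pr≡ = ∑-linear α _ _ _ (λ k → begin
  sgn k * P zero k * det (minor P k)
    ≡⟨ cong₂ (λ x y → sgn k * x * y) (Pr≡ k) (minor≡ M≈P k) ⟩
  sgn k * (α * M zero k + N zero k) * det (minor M k)
    ≡⟨ expand (sgn k) α (M zero k) (N zero k) (det (minor M k)) ⟩
  α * (sgn k * M zero k * det (minor M k)) + sgn k * N zero k * det (minor M k)
    ≡⟨ cong (λ y → α * (sgn k * M zero k * det (minor M k)) + sgn k * N zero k * y)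
         (trans (sym (minor≡ M≈P k)) (minor≡ N≈P k)) ⟩
  α * (sgn k * M zero k * det (minor M k)) + sgn k * N zero k * det (minor N k)
    ∎)
  where
  minor≡ : ∀ {Q} → (∀ i → i ≢ zero → ∀ k → Q i k ≡ P i k) → ∀ k → det (minor P k) ≡ det (minor Q k)
  minor≡ Q≈P k = det-cong (λ i l → sym (Q≈P (suc i) (λ ()) (punchIn k l)))
  expand : ∀ s α m n d → s * (α * m + n) * d ≡ α * (s * m * d) + s * n * d
  expand = solve-∀ ℚ-ring
det-linear {suc n} (suc r) α M N P M≈P N≈P Pr≡ = ∑-linear α _ _ _ (λ k → begin
  sgn k * P zero k * det (minor P k)
    ≡⟨ cong (sgn k * P zero k *_) (det-linear r α (minor M k) (minor N k) (minor P k)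
          (λ i i≢r l → M≈P (suc i) (i≢r ∘ suc-injective) (punchIn k l))
          (λ i i≢r l → N≈P (suc i) (i≢r ∘ suc-injective) (punchIn k l)) (Pr≡ ∘ punchIn k)) ⟩
  sgn k * P zero k * (α * det (minor M k) + det (minor N k))
    ≡⟨ expand (sgn k) α (P zero k) (det (minor M k)) (det (minor N k)) ⟩
  α * (sgn k * P zero k * det (minor M k)) + sgn k * P zero k * det (minor N k)
    ≡⟨ cong₂ (λ x y → α * (sgn k * x * det (minor M k)) + sgn k * y * det (minor N k))
         (sym (M≈P zero (λ ()) k)) (sym (N≈P zero (λ ()) k)) ⟩
  α * (sgn k * M zero k * det (minor M k)) + sgn k * N zero k * det (minor N k)
    ∎)
  where
  expand : ∀ s α p d e → s * p * (α * d + e) ≡ α * (s * p * d) + s * p * e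
  expand = solve-∀ ℚ-ring

det-zero-row : ∀ {n} (M : Matrix n) (r : Fin n) → (∀ k → M r k ≡ 0ℚ) → det M ≡ 0ℚ
det-zero-row {suc n} M zero Mr≡0 = ∑-zero _ (λ k → begin
  sgn k * M zero k * det (minor M k) ≡⟨ cong (λ x → sgn k * x * det (minor M k)) (Mr≡0 k) ⟩
  sgn k * 0ℚ * det (minor M k)       ≡⟨ cong (_* det (minor M k)) (ℚP.*-zeroʳ (sgn k)) ⟩
  0ℚ * det (minor M k)               ≡⟨ ℚP.*-zeroˡ (det (minor M k)) ⟩
  0ℚ                                 ∎)
det-zero-row {suc n} M (suc r) Mr≡0 = ∑-zero _ (λ k →
  trans (cong (sgn k * M zero k *_) (det-zero-row (minor M k) r (Mr≡0 ∘ punchIn k)))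
        (ℚP.*-zeroʳ (sgn k * M zero k)))

det-replaceRow-linear : ∀ {n} (A : Matrix n) (r : Fin n) (α : ℚ) (u v w : Vecℚ n) →
  (∀ c → w c ≡ α * u c + v c) →
  det (replaceRow A r w) ≡ α * det (replaceRow A r u) + det (replaceRow A r v)
det-replaceRow-linear A r α u v w w≗αu+v =
  det-linear r α (replaceRow A r u) (replaceRow A r v) (replaceRow A r w) (offRow u) (offRow v)
    (λ k → trans (cong-app (replaceRow-≡ A r w) k) (trans (w≗αu+v k)
      (sym (cong₂ (λ x y → α * x + y) (cong-app (replaceRow-≡ A r u) k) (cong-app (replaceRow-≡ A r v) k)))))
  where
  offRow : ∀ x i → i ≢ r → ∀ k → replaceRow A r x i k ≡ replaceRow A r w i k
  offRow x i i≢r = cong-app (trans (replaceRow-≢ A x i≢r) (sym (replaceRow-≢ A w i≢r)))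

det-replaceRow-+ : ∀ {n} (A : Matrix n) (r : Fin n) (u v : Vecℚ n) →
  det (replaceRow A r (λ c → u c + v c)) ≡ det (replaceRow A r u) + det (replaceRow A r v)
det-replaceRow-+ A r u v =
  trans (det-replaceRow-linear A r 1ℚ u v _ (λ c → cong (_+ v c) (sym (ℚP.*-identityˡ (u c)))))
        (cong (_+ det (replaceRow A r v)) (ℚP.*-identityˡ (det (replaceRow A r u))))

det-replaceRow-∑ : ∀ {n m} (A : Matrix n) (r : Fin n) (β : Fin m → ℚ) (B : Fin m → Vecℚ n) →
  det (replaceRow A r (λ c → ∑ (λ q → β q * B q c))) ≡ ∑ (λ q → β q * det (replaceRow A r (B q)))
det-replaceRow-∑ {m = zero} A r β B = det-zero-row _ r (cong-app (replaceRow-≡ A r (const 0ℚ)))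
det-replaceRow-∑ {n} {suc m} A r β B = begin
  det (replaceRow A r (λ c → β zero * B zero c + rest c))
    ≡⟨ det-replaceRow-linear A r (β zero) (B zero) rest _ (λ c → refl) ⟩
  β zero * det (replaceRow A r (B zero)) + det (replaceRow A r rest)
    ≡⟨ cong (β zero * det (replaceRow A r (B zero)) +_) (det-replaceRow-∑ A r (β ∘ suc) (B ∘ suc)) ⟩
  ∑ (λ q → β q * det (replaceRow A r (B q)))
    ∎
  where
  rest : Vecℚ n
  rest c = ∑ (λ q → β (suc q) * B (suc q) c)

det-replaceRow-cong : ∀ {n} (A : Matrix n) r {u v : Vecℚ n} → u ≗ v → det (replaceRow A r u) ≡ det (replaceRow A r v)
det-replaceRow-cong A r {u} {v} u≗v = det-cong rows
  where
  rows : ∀ t c → replaceRow A r u t c ≡ replaceRow A r v t c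
  rows t c with t Fin.≟ r
  ... | yes refl = trans (cong-app (replaceRow-≡ A t u) c) (trans (u≗v c) (sym (cong-app (replaceRow-≡ A t v) c)))
  ... | no t≢r = trans (cong-app (replaceRow-≢ A u t≢r) c) (sym (cong-app (replaceRow-≢ A v t≢r) c))

-- A c q (c ≢ q) is the signed determinant of M without rows 0, 1 and columns c, q.
module TwoRowExpansion {n} (M : Matrix (suc (suc n))) where

  C : Fin (suc (suc n)) → Fin (suc n) → ℚ
  C c l = det (minor (minor M c) l)

  A : Fin (suc (suc n)) → Fin (suc (suc n)) → ℚ
  A c q with c Fin.≟ q
  ... | yes _ = 0ℚ
  ... | no c≢q = sgn c * sgn (punchOut c≢q) * C c (punchOut c≢q)

  A-diag : ∀ c → A c c ≡ 0ℚ
  A-diag c with c Fin.≟ c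
  ... | yes _ = refl
  ... | no c≢c = ⊥-elim (c≢c refl)

  A-punchIn : ∀ c l → A c (punchIn c l) ≡ sgn c * sgn l * C c l
  A-punchIn c l with c Fin.≟ punchIn c l
  ... | yes c≡ = ⊥-elim (punchInᵢ≢i c l (sym c≡))
  ... | no _ = cong (λ t → sgn c * sgn t * C c t) (trans (punchOut-cong c refl) (punchOut-punchIn c))

  A-antisym : ∀ c q → A c q ≡ - A q c
  A-antisym c q with c Fin.≟ q | q Fin.≟ c
  ... | yes _ | yes _ = refl
  ... | yes c≡q | no q≢c = ⊥-elim (q≢c (sym c≡q))
  ... | no c≢q | yes q≡c = ⊥-elim (c≢q (sym q≡c))
  ... | no c≢q | no q≢c = begin
    sgn c * sgn (punchOut c≢q) * C c (punchOut c≢q)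
      ≡⟨ cong₂ _*_ (sgn-punchOut c≢q q≢c)
           (det-cong (λ i m → cong (M (suc (suc i))) (punchIn-punchOut-comm c≢q q≢c m))) ⟩
    - (sgn q * sgn (punchOut q≢c)) * C q (punchOut q≢c)
      ≡⟨ ℚP.neg-distribˡ-* (sgn q * sgn (punchOut q≢c)) (C q (punchOut q≢c)) ⟨
    - (sgn q * sgn (punchOut q≢c) * C q (punchOut q≢c))
      ∎

  det≡∑∑ : det M ≡ ∑ (λ c → ∑ (λ q → M zero c * M (suc zero) q * A c q))
  det≡∑∑ = ∑-cong (λ c → sym (begin
    ∑ (λ q → M zero c * M (suc zero) q * A c q)
      ≡⟨ ∑-remove c (λ q → M zero c * M (suc zero) q * A c q) ⟩
    M zero c * M (suc zero) c * A c c + ∑ (λ l → M zero c * M (suc zero) (punchIn c l) * A c (punchIn c l))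
      ≡⟨ cong₂ _+_ (trans (cong (M zero c * M (suc zero) c *_) (A-diag c)) (ℚP.*-zeroʳ (M zero c * M (suc zero) c)))
           (∑-cong (λ l → cong (M zero c * M (suc zero) (punchIn c l) *_) (A-punchIn c l))) ⟩
    0ℚ + ∑ (λ l → M zero c * M (suc zero) (punchIn c l) * (sgn c * sgn l * C c l))
      ≡⟨ ℚP.+-identityˡ _ ⟩
    ∑ (λ l → M zero c * M (suc zero) (punchIn c l) * (sgn c * sgn l * C c l))
      ≡⟨ ∑-cong (λ l → regroup (M zero c) (M (suc zero) (punchIn c l)) (sgn c) (sgn l) (C c l)) ⟩
    ∑ (λ l → sgn c * M zero c * (sgn l * M (suc zero) (punchIn c l) * C c l))
      ≡⟨ *-distribˡ-∑ (sgn c * M zero c) (λ l → sgn l * M (suc zero) (punchIn c l) * C c l) ⟨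
    sgn c * M zero c * det (minor M c)
      ∎))
    where
    regroup : ∀ x y s t d → x * y * (s * t * d) ≡ s * x * (t * y * d)
    regroup = solve-∀ ℚ-ring

det-row₀≡row₁ : ∀ {n} (M : Matrix (suc (suc n))) → M zero ≗ M (suc zero) → det M ≡ 0ℚ
det-row₀≡row₁ {n} M row₀≗row₁ = begin
  det M                                                   ≡⟨ det≡∑∑ ⟩
  ∑ (λ c → ∑ (λ q → M zero c * M (suc zero) q * A c q))   ≡⟨ ∑-cong (λ c → ∑-cong (λ q →
                                                                cong (λ y → M zero c * y * A c q) (row₀≗row₁ q))) ⟨
  ∑ (λ c → ∑ (g c))                                       ≡⟨ ∑∑-antisymmetric g g-antisym ⟩
  0ℚ                                                      ∎
  where
  open TwoRowExpansion M
  g : Fin (suc (suc n)) → Fin (suc (suc n)) → ℚ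
  g c q = M zero c * M zero q * A c q
  g-antisym : ∀ c q → g c q ≡ - g q c
  g-antisym c q = trans (cong (M zero c * M zero q *_) (A-antisym c q)) (lemma (M zero c) (M zero q) (A q c))
    where
    lemma : ∀ x y a → x * y * (- a) ≡ - (y * x * a)
    lemma = solve-∀ ℚ-ring

Alternating : ℕ → Set
Alternating n = ∀ (M : Matrix n) {i k} → i ≢ k → M i ≗ M k → det M ≡ 0ℚ

module RowPair {n} (M : Matrix n) {i k : Fin n} (i≢k : i ≢ k) where

  X : Vecℚ n → Vecℚ n → Matrix n
  X x y = replaceRow (replaceRow M i x) k y

  Q : Vecℚ n → Vecℚ n → ℚ
  Q x y = det (X x y)

  X-i : ∀ x y → X x y i ≡ x
  X-i x y = trans (replaceRow-≢ _ y i≢k) (replaceRow-≡ M i x)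

  X-k : ∀ x y → X x y k ≡ y
  X-k x y = replaceRow-≡ _ k y

  Q-diag : Alternating n → ∀ z → Q z z ≡ 0ℚ
  Q-diag alt z = alt (X z z) i≢k (λ c → trans (cong-app (X-i z z) c) (sym (cong-app (X-k z z) c)))

  Q-additiveʳ : ∀ x y y′ → Q x (λ c → y c + y′ c) ≡ Q x y + Q x y′
  Q-additiveʳ x = det-replaceRow-+ (replaceRow M i x) k

  X≗ : ∀ x y → X x y ≗ replaceRow (replaceRow M k y) i x
  X≗ x y = updateAt-commutes k i (i≢k ∘ sym) M

  Q-additiveˡ : ∀ x x′ y → Q (λ c → x c + x′ c) y ≡ Q x y + Q x′ y
  Q-additiveˡ x x′ y = begin
    Q (λ c → x c + x′ c) y                                      ≡⟨ det-cong (cong-app ∘ X≗ _ y) ⟩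
    det (replaceRow (replaceRow M k y) i (λ c → x c + x′ c))    ≡⟨ det-replaceRow-+ (replaceRow M k y) i x x′ ⟩
    det (replaceRow (replaceRow M k y) i x) + det (replaceRow (replaceRow M k y) i x′)
      ≡⟨ cong₂ _+_ (det-cong (cong-app ∘ X≗ x y)) (det-cong (cong-app ∘ X≗ x′ y)) ⟨
    Q x y + Q x′ y                                              ∎

  Q≡det : ∀ {x y} (P : Matrix n) → P i ≗ x → P k ≗ y → (∀ t → t ≢ i → t ≢ k → P t ≗ M t) → Q x y ≡ det P
  Q≡det {x} {y} P Pi≗x Pk≗y P≗M = det-cong rows
    where
    rows : ∀ t c → X x y t c ≡ P t c
    rows t c with t Fin.≟ i | t Fin.≟ k
    ... | yes refl | _ = trans (cong-app (X-i x y) c) (sym (Pi≗x c))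
    ... | no _ | yes refl = trans (cong-app (X-k x y) c) (sym (Pk≗y c))
    ... | no t≢i | no t≢k = trans (cong-app (trans (replaceRow-≢ _ y t≢k) (replaceRow-≢ M x t≢i)) c)
                                  (sym (P≗M t t≢i t≢k c))

-- Q is additive in each argument and vanishes on the diagonal, so with s = M i + M k,
-- Q (M i) (M k) + Q (M k) (M i) = Q s s = 0.
det-swap : ∀ {n} → Alternating n → ∀ (M N : Matrix n) {i k} → i ≢ k →
           N i ≗ M k → N k ≗ M i → (∀ t → t ≢ i → t ≢ k → N t ≗ M t) → det N ≡ - det M
det-swap {n} alt M N {i} {k} i≢k Ni≗Mk Nk≗Mi N≗M = +-inverseʳ-unique (det M) (det N) (begin
  det M + det N                                     ≡⟨ cong₂ _+_ (Q≡det M (λ _ → refl) (λ _ → refl) (λ _ _ _ _ → refl))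
                                                                  (Q≡det N Ni≗Mk Nk≗Mi N≗M) ⟨
  Q (M i) (M k) + Q (M k) (M i)                     ≡⟨ cong₂ _+_ (sym (ℚP.+-identityˡ (Q (M i) (M k))))
                                                                  (sym (ℚP.+-identityʳ (Q (M k) (M i)))) ⟩
  (0ℚ + Q (M i) (M k)) + (Q (M k) (M i) + 0ℚ)       ≡⟨ cong₂ (λ x y → (x + Q (M i) (M k)) + (Q (M k) (M i) + y))
                                                                  (Q-diag alt (M i)) (Q-diag alt (M k)) ⟨
  (Q (M i) (M i) + Q (M i) (M k)) + (Q (M k) (M i) + Q (M k) (M k))
                                                    ≡⟨ cong₂ _+_ (Q-additiveʳ (M i) (M i) (M k)) (Q-additiveʳ (M k) (M i) (M k)) ⟨
  Q (M i) s + Q (M k) s                             ≡⟨ Q-additiveˡ (M i) (M k) s ⟨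
  Q s s                                             ≡⟨ Q-diag alt s ⟩
  0ℚ                                                ∎)
  where
  open RowPair M i≢k
  s : Vecℚ n
  s c = M i c + M k c

det-row₀≡row-suc : ∀ {n} → Alternating n → ∀ (M : Matrix (suc n)) k → M zero ≗ M (suc k) → det M ≡ 0ℚ
det-row₀≡row-suc {suc n} alt M zero row₀≗row₁ = det-row₀≡row₁ M row₀≗row₁
-- Exchanging rows 1 and K negates every minor and makes rows 0 and 1 equal.
det-row₀≡row-suc {suc n} alt M (suc k) row₀≗rowK = begin
  det M        ≡⟨ neg-involutive (det M) ⟨
  - (- det M)  ≡⟨ cong -_ det-M′≡-det-M ⟨
  - det M′     ≡⟨ cong -_ (det-row₀≡row₁ M′ (λ c → trans (row₀≗rowK c) (sym (cong-app M′-1 c)))) ⟩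
  - 0ℚ         ≡⟨⟩
  0ℚ           ∎
  where
  K : Fin (suc (suc n))
  K = suc (suc k)
  M₁ M′ : Matrix (suc (suc n))
  M₁ = replaceRow M (suc zero) (M K)
  M′ = replaceRow M₁ K (M (suc zero))
  M′-1 : M′ (suc zero) ≡ M K
  M′-1 = trans (replaceRow-≢ M₁ {K} {suc zero} (M (suc zero)) (λ ())) (replaceRow-≡ M (suc zero) (M K))
  M′-K : M′ K ≡ M (suc zero)
  M′-K = replaceRow-≡ M₁ K (M (suc zero))
  M′-other : ∀ t → t ≢ zero → t ≢ suc k → M′ (suc t) ≡ M (suc t)
  M′-other t t≢0 t≢k = trans (replaceRow-≢ M₁ (M (suc zero)) (t≢k ∘ suc-injective))
                             (replaceRow-≢ M (M K) (t≢0 ∘ suc-injective))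
  minor-swap : ∀ c → det (minor M′ c) ≡ - det (minor M c)
  minor-swap c = det-swap alt (minor M c) (minor M′ c) {zero} {suc k} (λ ())
    (λ l → cong-app M′-1 (punchIn c l)) (λ l → cong-app M′-K (punchIn c l))
    (λ t t≢0 t≢k l → cong-app (M′-other t t≢0 t≢k) (punchIn c l))
  det-M′≡-det-M : det M′ ≡ - det M
  det-M′≡-det-M = begin
    ∑ (λ c → sgn c * M zero c * det (minor M′ c))    ≡⟨ ∑-cong (λ c → cong (sgn c * M zero c *_) (minor-swap c)) ⟩
    ∑ (λ c → sgn c * M zero c * - det (minor M c))  ≡⟨ ∑-cong (λ c → ℚP.neg-distribʳ-* (sgn c * M zero c) (det (minor M c))) ⟨
    ∑ (λ c → - (sgn c * M zero c * det (minor M c))) ≡⟨ neg-distrib-∑ (λ c → sgn c * M zero c * det (minor M c)) ⟨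
    - det M                                          ∎

det-alternating : ∀ n → Alternating n
det-alternating zero M {()}
det-alternating (suc n) M {zero} {zero} 0≢0 _ = ⊥-elim (0≢0 refl)
det-alternating (suc n) M {zero} {suc k} _ row₀≗rowk = det-row₀≡row-suc (det-alternating n) M k row₀≗rowk
det-alternating (suc n) M {suc i} {zero} _ rowi≗row₀ = det-row₀≡row-suc (det-alternating n) M i (sym ∘ rowi≗row₀)
det-alternating (suc n) M {suc i} {suc k} i≢k rowi≗rowk = ∑-zero _ (λ c →
  trans (cong (sgn c * M zero c *_) (det-alternating n (minor M c) (i≢k ∘ cong suc) (rowi≗rowk ∘ punchIn c)))
        (ℚP.*-zeroʳ (sgn c * M zero c)))

det-replaceRow-self : ∀ {n} (A : Matrix n) r → det (replaceRow A r (A r)) ≡ det A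
det-replaceRow-self A r = det-cong rows
  where
  rows : ∀ t c → replaceRow A r (A r) t c ≡ A t c
  rows t c with t Fin.≟ r
  ... | yes refl = cong-app (replaceRow-≡ A t (A t)) c
  ... | no t≢r = cong-app (replaceRow-≢ A (A r) t≢r) c

det-replaceRow-duplicate : ∀ {n} (A : Matrix n) {r t} → t ≢ r → det (replaceRow A r (A t)) ≡ 0ℚ
det-replaceRow-duplicate A {r} {t} t≢r = det-alternating _ (replaceRow A r (A t)) t≢r
  (λ c → trans (cong-app (replaceRow-≢ A (A t) t≢r) c) (sym (cong-app (replaceRow-≡ A r (A t)) c)))

rowToTop : ∀ {m} {A : Set} → (Fin (suc m) → A) → Fin (suc m) → Fin (suc m) → A
rowToTop M r zero = M r
rowToTop M r (suc t) = M (punchIn r t)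

det-rowToTop : ∀ {n} (M : Matrix (suc n)) r → det (rowToTop M r) ≡ sgn r * det M
det-rowToTop M zero = trans (det-cong rows) (sym (ℚP.*-identityˡ (det M)))
  where
  rows : ∀ i k → rowToTop M zero i k ≡ M i k
  rows zero k = refl
  rows (suc i) k = refl
det-rowToTop {suc n} M (suc r) = begin
  det (rowToTop M (suc r))  ≡⟨ det-swap (det-alternating (suc (suc n))) S (rowToTop M (suc r)) {zero} {suc zero} (λ ())
                                 (λ _ → refl) (λ _ → refl) S-others ⟩
  - det S                   ≡⟨ cong -_ det-S ⟩
  - (sgn r * det M)         ≡⟨ ℚP.neg-distribˡ-* (sgn r) (det M) ⟩
  sgn (suc r) * det M       ∎
  where
  S : Matrix (suc (suc n))
  S zero = M zero
  S (suc t) = rowToTop (M ∘ suc) r t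
  S-others : ∀ t → t ≢ zero → t ≢ suc zero → rowToTop M (suc r) t ≗ S t
  S-others zero t≢0 _ = ⊥-elim (t≢0 refl)
  S-others (suc zero) _ t≢1 = ⊥-elim (t≢1 refl)
  S-others (suc (suc t)) _ _ _ = refl
  minor-S : ∀ k i l → minor S k i l ≡ rowToTop (minor M k) r i l
  minor-S k zero l = refl
  minor-S k (suc i) l = refl
  det-S : det S ≡ sgn r * det M
  det-S = begin
    ∑ (λ k → sgn k * M zero k * det (minor S k))
      ≡⟨ ∑-cong (λ k → cong (sgn k * M zero k *_) (trans (det-cong (minor-S k)) (det-rowToTop (minor M k) r))) ⟩
    ∑ (λ k → sgn k * M zero k * (sgn r * det (minor M k)))
      ≡⟨ ∑-cong (λ k → *-ℚ.x∙yz≈y∙xz (sgn k * M zero k) (sgn r) (det (minor M k))) ⟩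
    ∑ (λ k → sgn r * (sgn k * M zero k * det (minor M k)))
      ≡⟨ *-distribˡ-∑ (sgn r) (λ k → sgn k * M zero k * det (minor M k)) ⟨
    sgn r * det M
      ∎

-- Bringing the row b j to the top of both matrices yields the same matrix.
det-omit-replace : ∀ {n} (b : Fin (suc (suc n)) → Vecℚ (suc n)) {i j} (j≢i : j ≢ i) (i≢j : i ≢ j) →
                   sgn j * det (replaceRow (omit j b) (punchOut j≢i) (b j)) ≡ - (sgn i * det (omit i b))
det-omit-replace {n} b {i} {j} j≢i i≢j = begin
  sgn j * det U                          ≡⟨ cong (sgn j *_) (trans (sym (ℚP.*-identityˡ (det U))) (cong (_* det U) (sym (sgn²≡1 r)))) ⟩
  sgn j * (sgn r * sgn r * det U)        ≡⟨ regroup (sgn j) (sgn r) (det U) ⟩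
  (sgn j * sgn r) * (sgn r * det U)      ≡⟨ cong₂ _*_ (sgn-punchOut j≢i i≢j) rotate ⟩
  - (sgn i * sgn r₂) * (sgn r₂ * D)      ≡⟨ ℚP.neg-distribˡ-* (sgn i * sgn r₂) (sgn r₂ * D) ⟨
  - (sgn i * sgn r₂ * (sgn r₂ * D))      ≡⟨ cong -_ (regroup (sgn i) (sgn r₂) D) ⟨
  - (sgn i * (sgn r₂ * sgn r₂ * D))      ≡⟨ cong (λ x → - (sgn i * (x * D))) (sgn²≡1 r₂) ⟩
  - (sgn i * (1ℚ * D))                   ≡⟨ cong (λ x → - (sgn i * x)) (ℚP.*-identityˡ D) ⟩
  - (sgn i * D)                          ∎
  where
  r r₂ : Fin (suc n)
  r = punchOut j≢i
  r₂ = punchOut i≢j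
  U : Matrix (suc n)
  U = replaceRow (omit j b) r (b j)
  D : ℚ
  D = det (omit i b)
  regroup : ∀ x y d → x * (y * y * d) ≡ (x * y) * (y * d)
  regroup = solve-∀ ℚ-ring
  rows : ∀ t c → rowToTop U r t c ≡ rowToTop (omit i b) r₂ t c
  rows zero c = trans (cong-app (replaceRow-≡ (omit j b) r (b j)) c) (cong (λ x → b x c) (sym (punchIn-punchOut i≢j)))
  rows (suc t) c = trans (cong-app (replaceRow-≢ (omit j b) (b j) (punchInᵢ≢i r t)) c)
                         (cong (λ x → b x c) (punchIn-punchOut-comm j≢i i≢j t))
  rotate : sgn r * det U ≡ sgn r₂ * D
  rotate = trans (sym (det-rowToTop U r)) (trans (det-cong rows) (det-rowToTop (omit i b) r₂))

cofactor : ∀ {n} → (Fin (suc n) → Vecℚ n) → Fin (suc n) → ℚ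
cofactor a j = sgn j * det (omit j a)

-- Cramer: in omit j a, replace row r (which is a i) by ∑_k λ_k a_k = 0 and expand by
-- linearity; only the terms k = j and k = i survive.
cofactor-proportional : ∀ {n} (a : Fin (suc n) → Vecℚ n) (lam : Fin (suc n) → ℚ) → IsRelation a lam →
                        ∀ i j → lam i * cofactor a j ≡ lam j * cofactor a i
cofactor-proportional {zero} a lam rel zero zero = refl
cofactor-proportional {suc n} a lam rel i j with i Fin.≟ j
... | yes refl = refl
... | no i≢j = begin
  lam i * (sgn j * det A)                                  ≡⟨ rearrange (lam i) (lam j) (sgn j) (det A) X ⟩
  sgn j * (lam j * X + lam i * det A) - lam j * (sgn j * X) ≡⟨ cong₂ (λ x y → sgn j * x - lam j * y) expansion
                                                                     (det-omit-replace a j≢i i≢j) ⟩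
  sgn j * 0ℚ - lam j * (- cofactor a i)                    ≡⟨ simplify (sgn j) (lam j) (cofactor a i) ⟩
  lam j * cofactor a i                                     ∎
  where
  j≢i : j ≢ i
  j≢i = i≢j ∘ sym
  A : Matrix (suc n)
  A = omit j a
  r : Fin (suc n)
  r = punchOut j≢i
  X : ℚ
  X = det (replaceRow A r (a j))
  relationRow : Vecℚ (suc n)
  relationRow c = ∑ (λ k → lam k * a k c)
  rearrange : ∀ li lj s d x → li * (s * d) ≡ s * (lj * x + li * d) - lj * (s * x)
  rearrange = solve-∀ ℚ-ring
  simplify : ∀ s l c → s * 0ℚ - l * (- c) ≡ l * c
  simplify = solve-∀ ℚ-ring
  expansion : lam j * X + lam i * det A ≡ 0ℚ
  expansion = sym (begin
    0ℚ
      ≡⟨ det-zero-row (replaceRow A r relationRow) r (λ c → trans (cong-app (replaceRow-≡ A r relationRow) c) (rel c)) ⟨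
    det (replaceRow A r (λ c → ∑ (λ k → lam k * a k c)))
      ≡⟨ det-replaceRow-∑ A r lam a ⟩
    ∑ (λ k → lam k * det (replaceRow A r (a k)))
      ≡⟨ ∑-remove j (λ k → lam k * det (replaceRow A r (a k))) ⟩
    lam j * X + ∑ (λ t → lam (punchIn j t) * det (replaceRow A r (A t)))
      ≡⟨ cong (lam j * X +_) (∑-single r _ (λ t t≢r →
           trans (cong (lam (punchIn j t) *_) (det-replaceRow-duplicate A t≢r)) (ℚP.*-zeroʳ (lam (punchIn j t))))) ⟩
    lam j * X + lam (punchIn j r) * det (replaceRow A r (A r))
      ≡⟨ cong₂ (λ x y → lam j * X + lam x * y) (punchIn-punchOut j≢i) (det-replaceRow-self A r) ⟩
    lam j * X + lam i * det A
      ∎)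

-- Linear forms and the dual basis

·-comm : ∀ {n} (b x : Vecℚ n) → b · x ≡ x · b
·-comm b x = ∑-cong (λ c → ℚP.*-comm (b c) (x c))

·-∑ : ∀ {n p} (b x : Vecℚ n) (t : Fin p → ℚ) (g : Fin p → Vecℚ n) →
      (∀ c → x c ≡ ∑ (λ q → t q * g q c)) → b · x ≡ ∑ (λ q → t q * (b · g q))
·-∑ b x t g x≡∑tg = begin
  ∑ (λ c → b c * x c)                       ≡⟨ ∑-cong (λ c → trans (cong (b c *_) (x≡∑tg c))
                                                                  (*-distribˡ-∑ (b c) (λ q → t q * g q c))) ⟩
  ∑ (λ c → ∑ (λ q → b c * (t q * g q c)))   ≡⟨ ∑-comm (λ c q → b c * (t q * g q c)) ⟩
  ∑ (λ q → ∑ (λ c → b c * (t q * g q c)))   ≡⟨ ∑-cong (λ q → trans (∑-cong (λ c → *-ℚ.x∙yz≈y∙xz (b c) (t q) (g q c)))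
                                                                  (sym (*-distribˡ-∑ (t q) (λ c → b c * g q c)))) ⟩
  ∑ (λ q → t q * (b · g q))                 ∎

·-scaleʳ : ∀ {n} (b v : Vecℚ n) (s : ℚ) → b · (λ c → s * v c) ≡ s * (b · v)
·-scaleʳ b v s = trans (∑-cong (λ c → *-ℚ.x∙yz≈y∙xz (b c) s (v c))) (sym (*-distribˡ-∑ s (λ c → b c * v c)))

·-zeroʳ : ∀ {n} (b y : Vecℚ n) → IsZero y → b · y ≡ 0ℚ
·-zeroʳ b y y≗0 = ∑-zero _ (λ c → trans (cong (b c *_) (y≗0 c)) (ℚP.*-zeroʳ (b c)))

·-sub : ∀ {n} (b x z : Vecℚ n) → b · (λ c → x c - z c) ≡ b · x - b · z
·-sub b x z = begin
  ∑ (λ c → b c * (x c - z c))           ≡⟨ ∑-cong (λ c → trans (ℚP.*-distribˡ-+ (b c) (x c) (- z c))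
                                                              (cong (b c * x c +_) (sym (ℚP.neg-distribʳ-* (b c) (z c))))) ⟩
  ∑ (λ c → b c * x c + - (b c * z c))   ≡⟨ ∑-distrib-+ (λ c → b c * x c) (λ c → - (b c * z c)) ⟩
  b · x + ∑ (λ c → - (b c * z c))       ≡⟨ cong (b · x +_) (neg-distrib-∑ (λ c → b c * z c)) ⟨
  b · x - b · z                         ∎

·-≢0⇒nonzero : ∀ {n} (b v : Vecℚ n) → b · v ≢ 0ℚ → ¬ IsZero v
·-≢0⇒nonzero b v b·v≢0 v≗0 = b·v≢0 (·-zeroʳ b v v≗0)

unit : ∀ {n} → Fin n → Vecℚ n
unit l c = 𝟙 (c Fin.≟ l)

·-unit : ∀ {n} (y : Vecℚ n) (l : Fin n) → y · unit l ≡ y l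
·-unit y l = begin
  ∑ (λ c → y c * unit l c) ≡⟨ ∑-single l _ (λ c c≢l → trans (cong (y c *_) (𝟙-no (c Fin.≟ l) c≢l)) (ℚP.*-zeroʳ (y c))) ⟩
  y l * unit l l           ≡⟨ cong (y l *_) (𝟙-yes (l Fin.≟ l) refl) ⟩
  y l * 1ℚ                 ≡⟨ ℚP.*-identityʳ (y l) ⟩
  y l                      ∎

∑-unit : ∀ {n} (v : Vecℚ n) (c : Fin n) → v c ≡ ∑ (λ l → v l * unit l c)
∑-unit v c = begin
  v c                       ≡⟨ ·-unit v c ⟨
  v · unit c                ≡⟨ ∑-cong (λ l → cong (v l *_) (sym (unit-sym l))) ⟩
  ∑ (λ l → v l * unit l c)  ∎
  where
  unit-sym : ∀ l → unit l c ≡ unit c l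
  unit-sym l with c Fin.≟ l | l Fin.≟ c
  ... | yes _ | yes _ = refl
  ... | no _ | no _ = refl
  ... | yes c≡l | no l≢c = ⊥-elim (l≢c (sym c≡l))
  ... | no c≢l | yes l≡c = ⊥-elim (c≢l (sym l≡c))

relation-· : ∀ {n} (a : Fin (suc n) → Vecℚ n) (lam : Fin (suc n) → ℚ) → IsRelation a lam →
             ∀ y → ∑ (λ j → lam j * (a j · y)) ≡ 0ℚ
relation-· a lam rel y = begin
  ∑ (λ j → lam j * (a j · y))   ≡⟨ ∑-cong (λ j → cong (lam j *_) (·-comm (a j) y)) ⟩
  ∑ (λ j → lam j * (y · a j))   ≡⟨ ·-∑ y (const 0ℚ) lam a (sym ∘ rel) ⟨
  y · const 0ℚ                  ≡⟨ ·-zeroʳ y (const 0ℚ) (λ _ → refl) ⟩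
  0ℚ                            ∎

neg-relation : ∀ {n} (a : Fin (suc n) → Vecℚ n) (lam : Fin (suc n) → ℚ) → IsRelation a lam → IsRelation a (λ j → - lam j)
neg-relation a lam rel k = begin
  ∑ (λ j → - lam j * a j k)    ≡⟨ ∑-cong (λ j → ℚP.neg-distribˡ-* (lam j) (a j k)) ⟨
  ∑ (λ j → - (lam j * a j k))  ≡⟨ neg-distrib-∑ (λ j → lam j * a j k) ⟨
  - ∑ (λ j → lam j * a j k)    ≡⟨ cong -_ (rel k) ⟩
  0ℚ                           ∎

generates⇒injective : ∀ {n} (a : Fin (suc n) → Vecℚ n) → Generates a → ∀ y → (∀ j → a j · y ≡ 0ℚ) → IsZero y
generates⇒injective a gen y a·y≡0 k with gen (unit k)
... | μ , unitₖ≡∑μa = begin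
  y k                        ≡⟨ ·-unit y k ⟨
  y · unit k                 ≡⟨ ·-∑ y (unit k) μ a unitₖ≡∑μa ⟩
  ∑ (λ j → μ j * (y · a j))  ≡⟨ ∑-zero _ (λ j → trans (cong (μ j *_) (trans (·-comm y (a j)) (a·y≡0 j)))
                                                      (ℚP.*-zeroʳ (μ j))) ⟩
  0ℚ                         ∎

module DualBasis {n} (a : Fin (suc n) → Vecℚ n) (lam : Fin (suc n) → ℚ) (rel : IsRelation a lam)
                 (gen : Generates a) (j : Fin (suc n)) (lamⱼ≢0 : lam j ≢ 0ℚ) (Dⱼ≢0 : det (omit j a) ≢ 0ℚ) where

  A : Matrix n
  A = omit j a

  instance
    Dⱼ-nonZero : NonZero (det A)
    Dⱼ-nonZero = ≢-nonZero Dⱼ≢0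

  -- The columns of the adjugate of A, divided by det A: the basis dual to the rows of A.
  w : Fin n → Vecℚ n
  w r l = det (replaceRow A r (unit l)) * 1/ det A

  A·w : ∀ r′ r → A r′ · w r ≡ 𝟙 (r′ Fin.≟ r)
  A·w r′ r = begin
    ∑ (λ l → A r′ l * (det (replaceRow A r (unit l)) * 1/ det A))
      ≡⟨ ∑-cong (λ l → ℚP.*-assoc (A r′ l) _ (1/ det A)) ⟨
    ∑ (λ l → A r′ l * det (replaceRow A r (unit l)) * 1/ det A)
      ≡⟨ *-distribʳ-∑ (1/ det A) (λ l → A r′ l * det (replaceRow A r (unit l))) ⟨
    ∑ (λ l → A r′ l * det (replaceRow A r (unit l))) * 1/ det A
      ≡⟨ cong (_* 1/ det A) (det-replaceRow-∑ A r (A r′) unit) ⟨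
    det (replaceRow A r (λ c → ∑ (λ l → A r′ l * unit l c))) * 1/ det A
      ≡⟨ cong (_* 1/ det A) (det-replaceRow-cong A r (sym ∘ ∑-unit (A r′))) ⟩
    det (replaceRow A r (A r′)) * 1/ det A
      ≡⟨ kronecker (r′ Fin.≟ r) ⟩
    𝟙 (r′ Fin.≟ r)
      ∎
    where
    kronecker : (d : Dec (r′ ≡ r)) → det (replaceRow A r (A r′)) * 1/ det A ≡ 𝟙 d
    kronecker (yes refl) = trans (cong (_* 1/ det A) (det-replaceRow-self A r)) (ℚP.*-inverseʳ (det A))
    kronecker (no r′≢r) = trans (cong (_* 1/ det A) (det-replaceRow-duplicate A r′≢r)) (ℚP.*-zeroˡ (1/ det A))

  a·w : ∀ i (j≢i : j ≢ i) r → a i · w r ≡ 𝟙 (punchOut j≢i Fin.≟ r)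
  a·w i j≢i r = subst (λ t → a t · w r ≡ 𝟙 (punchOut j≢i Fin.≟ r)) (punchIn-punchOut j≢i) (A·w (punchOut j≢i) r)

  A·w-diag : ∀ r → A r · w r ≡ 1ℚ
  A·w-diag r = trans (A·w r r) (𝟙-yes (r Fin.≟ r) refl)

  -- x − ∑ (A r · x) w r is killed by the rows of A, hence by a j through the relation, hence is 0.
  decomposition : ∀ x c → x c ≡ ∑ (λ r → (A r · x) * w r c)
  decomposition x c = x-y≡0⇒x≡y (x c) (comb c) (generates⇒injective a gen y a·y≡0 c)
    where
    comb : Vecℚ n
    comb c = ∑ (λ r → (A r · x) * w r c)
    y : Vecℚ n
    y c = x c - comb c
    A·comb : ∀ r′ → A r′ · comb ≡ A r′ · x
    A·comb r′ = begin
      A r′ · comb                         ≡⟨ ·-∑ (A r′) comb (λ r → A r · x) w (λ _ → refl) ⟩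
      ∑ (λ r → (A r · x) * (A r′ · w r))  ≡⟨ ∑-single r′ _ off-diagonal ⟩
      (A r′ · x) * (A r′ · w r′)          ≡⟨ cong ((A r′ · x) *_) (A·w-diag r′) ⟩
      (A r′ · x) * 1ℚ                     ≡⟨ ℚP.*-identityʳ (A r′ · x) ⟩
      A r′ · x                            ∎
      where
      off-diagonal : ∀ r → r ≢ r′ → (A r · x) * (A r′ · w r) ≡ 0ℚ
      off-diagonal r r≢r′ = trans (cong ((A r · x) *_) (trans (A·w r′ r) (𝟙-no (r′ Fin.≟ r) (r≢r′ ∘ sym))))
                                  (ℚP.*-zeroʳ (A r · x))
    A·y≡0 : ∀ r′ → A r′ · y ≡ 0ℚ
    A·y≡0 r′ = trans (·-sub (A r′) x comb) (trans (cong (_-_ (A r′ · x)) (A·comb r′)) (ℚP.+-inverseʳ (A r′ · x)))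
    aⱼ·y≡0 : a j · y ≡ 0ℚ
    aⱼ·y≡0 = x*y≡0⇒y≡0 lamⱼ≢0 (begin
      lam j * (a j · y)                                            ≡⟨ ℚP.+-identityʳ _ ⟨
      lam j * (a j · y) + 0ℚ                                       ≡⟨ cong (lam j * (a j · y) +_) others≡0 ⟨
      lam j * (a j · y) + ∑ (λ t → lam (punchIn j t) * (A t · y))  ≡⟨ ∑-remove j (λ i → lam i * (a i · y)) ⟨
      ∑ (λ i → lam i * (a i · y))                                  ≡⟨ relation-· a lam rel y ⟩
      0ℚ                                                           ∎)
      where
      others≡0 : ∑ (λ t → lam (punchIn j t) * (A t · y)) ≡ 0ℚ
      others≡0 = ∑-zero _ (λ t → trans (cong (lam (punchIn j t) *_) (A·y≡0 t)) (ℚP.*-zeroʳ (lam (punchIn j t))))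
    a·y≡0 : ∀ i → a i · y ≡ 0ℚ
    a·y≡0 i with i Fin.≟ j
    ... | yes refl = aⱼ·y≡0
    ... | no i≢j = subst (λ t → a t · y ≡ 0ℚ) (punchIn-punchOut (i≢j ∘ sym)) (A·y≡0 (punchOut (i≢j ∘ sym)))

-- Dual cones containing a line

cdual-∏ : ∀ {n m} (b : Fin m → Vecℚ n) x → cdual b x ≡ ∏ (λ i → 𝟙 (0ℚ ≤? b i · x))
cdual-∏ {m = zero} b x = refl
cdual-∏ {m = suc m} b x with 0ℚ ≤? b zero · x
... | yes 0≤b₀x = trans (cdual-∏ (b ∘ suc) x)
  (sym (trans (cong (_* ∏ u) (𝟙-yes (0ℚ ≤? b zero · x) 0≤b₀x)) (ℚP.*-identityˡ (∏ u))))
  where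
  u : Fin m → ℚ
  u i = 𝟙 (0ℚ ≤? b (suc i) · x)
... | no 0≰b₀x = sym (trans (cong (_* ∏ u) (𝟙-no (0ℚ ≤? b zero · x) 0≰b₀x)) (ℚP.*-zeroˡ (∏ u)))
  where
  u : Fin m → ℚ
  u i = 𝟙 (0ℚ ≤? b (suc i) · x)

InDualCone : ∀ {m n} → (Fin m → Vecℚ n) → Subset m → Vecℚ n → Set
InDualCone a T x = ∀ i → lookup T i ≡ inside → 0ℚ ≤ a i · x

inDualCone? : ∀ {m n} (a : Fin m → Vecℚ n) T x i → Dec (lookup T i ≡ inside → 0ℚ ≤ a i · x)
inDualCone? a T x i = (lookup T i Bool.≟ inside) →-dec (0ℚ ≤? a i · x)

dualConeIndicator : ∀ {m n} → (Fin m → Vecℚ n) → Subset m → Vecℚ n → ℚ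
dualConeIndicator a T x = ∏ (λ i → 𝟙 (inDualCone? a T x i))

module DualConeWithLine {n} (a : Fin (suc n) → Vecℚ n) (lam : Fin (suc n) → ℚ) (rel : IsRelation a lam)
  (gen : Generates a) {j k : Fin (suc n)} (j≢k : j ≢ k) (lamⱼ≢0 : lam j ≢ 0ℚ) (Dⱼ≢0 : det (omit j a) ≢ 0ℚ)
  (T : Subset (suc n)) (j∉T : lookup T j ≡ outside) (k∉T : lookup T k ≡ outside) where

  open DualBasis a lam rel gen j lamⱼ≢0 Dⱼ≢0

  ∈T⇒≢j : ∀ {i} → lookup T i ≡ inside → j ≢ i
  ∈T⇒≢j i∈T refl with trans (sym i∈T) j∉T
  ... | ()

  σ : Fin n → ℚ
  σ r = if lookup T (punchIn j r) then 1ℚ else - 1ℚ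

  σ-inside : ∀ r → lookup T (punchIn j r) ≡ inside → σ r ≡ 1ℚ
  σ-inside r r∈T rewrite r∈T = refl

  σ≢0 : ∀ r → σ r ≢ 0ℚ
  σ≢0 r with lookup T (punchIn j r)
  ... | inside = λ ()
  ... | outside = λ ()

  -- Generators w r and σ r · w r: the vector w r twice if row r is in T, both ±w r otherwise.
  gens : Fin (n ℕ.+ n) → Vecℚ n
  gens = w ++ (λ r c → σ r * w r c)

  split : ∀ x → InDualCone a T x → ∀ r →
          Σ ℚ λ s₁ → Σ ℚ λ s₂ → 0ℚ ≤ s₁ × 0ℚ ≤ s₂ × s₁ + s₂ * σ r ≡ A r · x
  split x a·x≥0 r with 0ℚ ≤? A r · x
  ... | yes 0≤α = A r · x , 0ℚ , 0≤α , ℚP.≤-refl , lemma (A r · x) (σ r)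
    where
    lemma : ∀ α s → α + 0ℚ * s ≡ α
    lemma = solve-∀ ℚ-ring
  ... | no 0≰α with lookup T (punchIn j r) in r-side
  ...   | inside = ⊥-elim (0≰α (a·x≥0 (punchIn j r) r-side))
  ...   | outside = 0ℚ , - (A r · x) , ℚP.≤-refl , ℚP.neg-antimono-≤ (ℚP.<⇒≤ (ℚP.≰⇒> 0≰α)) , lemma (A r · x)
    where
    lemma : ∀ α → 0ℚ + - α * - 1ℚ ≡ α
    lemma = solve-∀ ℚ-ring

  InDualCone⇒InCone : ∀ x → InDualCone a T x → InCone gens x
  InDualCone⇒InCone x a·x≥0 = (t₁ ++ t₂) , t≥0 , sums
    where
    α : Fin n → ℚ
    α r = A r · x
    t₁ t₂ : Fin n → ℚ
    t₁ r = proj₁ (split x a·x≥0 r)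
    t₂ r = proj₁ (proj₂ (split x a·x≥0 r))
    t≥0 : ∀ q → 0ℚ ≤ (t₁ ++ t₂) q
    t≥0 q with splitAt n q
    ... | inj₁ r = proj₁ (proj₂ (proj₂ (split x a·x≥0 r)))
    ... | inj₂ r = proj₁ (proj₂ (proj₂ (proj₂ (split x a·x≥0 r))))
    per-r : ∀ r c → t₁ r * w r c + t₂ r * (σ r * w r c) ≡ α r * w r c
    per-r r c = trans (lemma (t₁ r) (t₂ r) (σ r) (w r c)) (cong (_* w r c) (proj₂ (proj₂ (proj₂ (proj₂ (split x a·x≥0 r))))))
      where
      lemma : ∀ s₁ s₂ s v → s₁ * v + s₂ * (s * v) ≡ (s₁ + s₂ * s) * v
      lemma = solve-∀ ℚ-ring
    split-q : ∀ c q → (t₁ ++ t₂) q * gens q c ≡ ((λ r → t₁ r * w r c) ++ (λ r → t₂ r * (σ r * w r c))) q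
    split-q c q with splitAt n q
    ... | inj₁ r = refl
    ... | inj₂ r = refl
    sums : ∀ c → x c ≡ ∑ (λ q → (t₁ ++ t₂) q * gens q c)
    sums c = sym (begin
      ∑ (λ q → (t₁ ++ t₂) q * gens q c)
        ≡⟨ ∑-cong (split-q c) ⟩
      ∑ ((λ r → t₁ r * w r c) ++ (λ r → t₂ r * (σ r * w r c)))
        ≡⟨ ∑-++ (λ r → t₁ r * w r c) (λ r → t₂ r * (σ r * w r c)) ⟩
      ∑ (λ r → t₁ r * w r c) + ∑ (λ r → t₂ r * (σ r * w r c))
        ≡⟨ ∑-distrib-+ (λ r → t₁ r * w r c) (λ r → t₂ r * (σ r * w r c)) ⟨
      ∑ (λ r → t₁ r * w r c + t₂ r * (σ r * w r c))
        ≡⟨ ∑-cong (λ r → per-r r c) ⟩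
      ∑ (λ r → α r * w r c)
        ≡⟨ decomposition x c ⟨
      x c
        ∎)

  a·gens≥0 : ∀ i → lookup T i ≡ inside → ∀ q → 0ℚ ≤ a i · gens q
  a·gens≥0 i i∈T q with splitAt n q
  ... | inj₁ r = subst (0ℚ ≤_) (sym (a·w i j≢i r)) (𝟙-nonneg (punchOut j≢i Fin.≟ r))
    where
    j≢i : j ≢ i
    j≢i = ∈T⇒≢j i∈T
  ... | inj₂ r = subst (0ℚ ≤_) (sym (trans (·-scaleʳ (a i) (w r) (σ r)) (cong (σ r *_) (a·w i j≢i r))))
                       (σ*𝟙≥0 (punchOut j≢i Fin.≟ r))
    where
    j≢i : j ≢ i
    j≢i = ∈T⇒≢j i∈T
    σ*𝟙≥0 : (d : Dec (punchOut j≢i ≡ r)) → 0ℚ ≤ σ r * 𝟙 d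
    σ*𝟙≥0 (yes refl) = subst (λ s → 0ℚ ≤ s * 1ℚ) (sym (σ-inside r
      (trans (cong (lookup T) (punchIn-punchOut j≢i)) i∈T))) 0≤1
    σ*𝟙≥0 (no _) = subst (0ℚ ≤_) (sym (ℚP.*-zeroʳ (σ r))) ℚP.≤-refl

  InCone⇒InDualCone : ∀ x → InCone gens x → InDualCone a T x
  InCone⇒InDualCone x (t , t≥0 , x≡∑tg) i i∈T = subst (0ℚ ≤_) (sym (·-∑ (a i) x t gens x≡∑tg))
    (∑-nonneg _ (λ q → *-nonneg (t≥0 q) (a·gens≥0 i i∈T q)))

  w-nonzero : ∀ r → ¬ IsZero (w r)
  w-nonzero r = ·-≢0⇒nonzero (A r) (w r) (λ A·w≡0 → ℚP.1≢0 (trans (sym (A·w-diag r)) A·w≡0))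

  gens-nonzero : ∀ q → ¬ IsZero (gens q)
  gens-nonzero q with splitAt n q
  ... | inj₁ r = w-nonzero r
  ... | inj₂ r = ·-≢0⇒nonzero (A r) (λ c → σ r * w r c)
    (λ A·σw≡0 → σ≢0 r (trans (sym (trans (cong (σ r *_) (A·w-diag r)) (ℚP.*-identityʳ (σ r))))
                           (trans (sym (·-scaleʳ (A r) (w r) (σ r))) A·σw≡0)))

  rₖ : Fin n
  rₖ = punchOut j≢k

  line-in-cone : ∀ s → InCone gens (λ c → s * w rₖ c)
  line-in-cone s = InDualCone⇒InCone _ (λ i i∈T → subst (0ℚ ≤_) (sym (a·line≡0 i i∈T)) ℚP.≤-refl)
    where
    a·line≡0 : ∀ i → lookup T i ≡ inside → a i · (λ c → s * w rₖ c) ≡ 0ℚ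
    a·line≡0 i i∈T = begin
      a i · (λ c → s * w rₖ c)            ≡⟨ ·-scaleʳ (a i) (w rₖ) s ⟩
      s * (a i · w rₖ)                    ≡⟨ cong (s *_) (trans (a·w i (∈T⇒≢j i∈T) rₖ)
                                                                (𝟙-no (punchOut (∈T⇒≢j i∈T) Fin.≟ rₖ) rᵢ≢rₖ)) ⟩
      s * 0ℚ                              ≡⟨ ℚP.*-zeroʳ s ⟩
      0ℚ                                  ∎
      where
      rᵢ≢rₖ : punchOut (∈T⇒≢j i∈T) ≢ rₖ
      rᵢ≢rₖ rᵢ≡rₖ with trans (sym i∈T) (trans (cong (lookup T) (punchOut-injective (∈T⇒≢j i∈T) j≢k rᵢ≡rₖ)) k∉T)
      ... | ()

  cone : LineCone n
  cone = record
    { p = n ℕ.+ n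
    ; gens = gens
    ; gensNonzero = gens-nonzero
    ; line = w rₖ
    ; lineNonzero = w-nonzero rₖ
    ; lineInCone = line-in-cone
    }

  InL-dualConeIndicator : InL (dualConeIndicator a T)
  InL-dualConeIndicator = InL-indicator cone (dualConeIndicator a T) indicator-val
    where
    indicator-val : ∀ x → IndVal cone x (dualConeIndicator a T x)
    indicator-val x with ∏-𝟙 (inDualCone? a T x)
    ... | inj₁ (a·x≥0 , ≡1) = inj₁ (InDualCone⇒InCone x a·x≥0 , ≡1)
    ... | inj₂ (a·x≱0 , ≡0) = inj₂ (a·x≱0 ∘ InCone⇒InDualCone x , ≡0)

delta-zero : ∀ {n} (x : Vecℚ n) → IsZero x → delta x ≡ 1ℚ
delta-zero {zero} x _ = refl
delta-zero {suc n} x x≗0 with x zero ≟ 0ℚ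
... | yes _ = delta-zero (x ∘ suc) (x≗0 ∘ suc)
... | no x₀≢0 = ⊥-elim (x₀≢0 (x≗0 zero))

delta-nonzero : ∀ {n} (x : Vecℚ n) → ¬ IsZero x → delta x ≡ 0ℚ
delta-nonzero {zero} x x≢0 = ⊥-elim (x≢0 (λ ()))
delta-nonzero {suc n} x x≢0 with x zero ≟ 0ℚ
... | yes x₀≡0 = delta-nonzero (x ∘ suc) (λ x′≗0 → x≢0 (λ { zero → x₀≡0 ; (suc i) → x′≗0 i }))
... | no _ = refl

cdual≡delta : ∀ {n} (a : Fin (suc n) → Vecℚ n) (lam : Fin (suc n) → ℚ) → IsRelation a lam → Generates a →
              (∀ j → 0ℚ < lam j) → ∀ x → cdual a x ≡ delta x
cdual≡delta a lam rel gen lam>0 x with ∏-𝟙 (λ i → 0ℚ ≤? a i · x)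
... | inj₁ (a·x≥0 , ∏≡1) = trans (cdual-∏ a x) (trans ∏≡1 (sym (delta-zero x (generates⇒injective a gen x a·x≡0))))
  where
  term≥0 : ∀ i → 0ℚ ≤ lam i * (a i · x)
  term≥0 i = *-nonneg (ℚP.<⇒≤ (lam>0 i)) (a·x≥0 i)
  a·x≡0 : ∀ i → a i · x ≡ 0ℚ
  a·x≡0 i = x*y≡0⇒y≡0 (pos⇒≢0 (lam>0 i))
    (ℚP.≤-antisym (ℚP.≮⇒≥ (λ 0<term → ℚP.<-irrefl (sym (relation-· a lam rel x)) (∑-pos _ i term≥0 0<term))) (term≥0 i))
... | inj₂ (a·x≱0 , ∏≡0) = trans (cdual-∏ a x) (trans ∏≡0 (sym (delta-nonzero x x≢0)))
  where
  x≢0 : ¬ IsZero x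
  x≢0 x≗0 = a·x≱0 (λ i → ℚP.≤-reflexive (sym (·-zeroʳ (a i) x x≗0)))

-- Inclusion–exclusion over the facets

𝟙-mismatch⇒*≤0 : ∀ {l v : ℚ} (d₁ : Dec (0ℚ < l)) (d₂ : Dec (0ℚ ≤ v)) → - 𝟙 d₁ + 𝟙 d₂ ≢ 0ℚ → l * v ≤ 0ℚ
𝟙-mismatch⇒*≤0 (yes _) (yes _) factor≢0 = ⊥-elim (factor≢0 refl)
𝟙-mismatch⇒*≤0 (yes 0<l) (no 0≰v) _ = ℚP.<⇒≤ (*-pos-neg 0<l (ℚP.≰⇒> 0≰v))
𝟙-mismatch⇒*≤0 (no 0≮l) (yes 0≤v) _ = *-nonpos-nonneg (ℚP.≮⇒≥ 0≮l) 0≤v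
𝟙-mismatch⇒*≤0 (no _) (no _) factor≢0 = ⊥-elim (factor≢0 refl)

𝟙-mismatch⇒*<0 : ∀ {l v : ℚ} → 0ℚ < l → (d₁ : Dec (0ℚ < l)) (d₂ : Dec (0ℚ ≤ v)) →
                 - 𝟙 d₁ + 𝟙 d₂ ≢ 0ℚ → l * v < 0ℚ
𝟙-mismatch⇒*<0 0<l (no 0≮l) _ _ = ⊥-elim (0≮l 0<l)
𝟙-mismatch⇒*<0 0<l (yes _) (yes _) factor≢0 = ⊥-elim (factor≢0 refl)
𝟙-mismatch⇒*<0 0<l (yes _) (no 0≰v) _ = *-pos-neg 0<l (ℚP.≰⇒> 0≰v)

positiveFacetSum : ∀ {n} → (Fin (suc n) → ℚ) → (Fin (suc n) → Vecℚ n) → Vecℚ n → ℚ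
positiveFacetSum lam a x = ∑ (λ j → 𝟙 (0ℚ <? lam j) * cdual (omit j a) x)

module FacetExpansion {n} (a : Fin (suc n) → Vecℚ n) (lam : Fin (suc n) → ℚ) where

  φ : Fin (suc n) → Bool → Vecℚ n → ℚ
  φ i inside x = 𝟙 (0ℚ ≤? a i · x)
  φ i outside x = - 𝟙 (0ℚ <? lam i)

  term : Subset (suc n) → Vecℚ n → ℚ
  term T x = ∏ (λ i → φ i (lookup T i) x)

  term-⊤ : ∀ x → term ⊤ x ≡ cdual a x
  term-⊤ x = trans (Πℚ.sum-cong-≗ (λ i → cong (λ b → φ i b x) (lookup-replicate i inside))) (sym (cdual-∏ a x))

  term-⊤-j : ∀ x j → term (⊤ [ j ]≔ outside) x ≡ - (𝟙 (0ℚ <? lam j) * cdual (omit j a) x)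
  term-⊤-j x j = begin
    ∏ (λ i → φ i (lookup ⊤ⱼ i) x)
      ≡⟨ Πℚ.sum-remove {i = j} (λ i → φ i (lookup ⊤ⱼ i) x) ⟩
    φ j (lookup ⊤ⱼ j) x * ∏ (λ l → φ (punchIn j l) (lookup ⊤ⱼ (punchIn j l)) x)
      ≡⟨ cong₂ _*_ (cong (λ b → φ j b x) (lookup∘update j ⊤ outside))
                   (Πℚ.sum-cong-≗ (λ l → cong (λ b → φ (punchIn j l) b x)
                     (trans (lookup∘update′ (punchInᵢ≢i j l) ⊤ outside) (lookup-replicate (punchIn j l) inside)))) ⟩
    - 𝟙 (0ℚ <? lam j) * ∏ (λ l → 𝟙 (0ℚ ≤? a (punchIn j l) · x))
      ≡⟨ cong (- 𝟙 (0ℚ <? lam j) *_) (cdual-∏ (omit j a) x) ⟨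
    - 𝟙 (0ℚ <? lam j) * cdual (omit j a) x
      ≡⟨ ℚP.neg-distribˡ-* (𝟙 (0ℚ <? lam j)) (cdual (omit j a) x) ⟨
    - (𝟙 (0ℚ <? lam j) * cdual (omit j a) x)
      ∎
    where
    ⊤ⱼ : Subset (suc n)
    ⊤ⱼ = ⊤ [ j ]≔ outside

  coefficient : Subset (suc n) → ℚ
  coefficient T = ∏ (λ i → if lookup T i then 1ℚ else - 𝟙 (0ℚ <? lam i))

  term≡coefficient*indicator : ∀ T x → term T x ≡ coefficient T * dualConeIndicator a T x
  term≡coefficient*indicator T x = trans (Πℚ.sum-cong-≗ factor)
    (Πℚ.∑-distrib-+ (λ i → if lookup T i then 1ℚ else - 𝟙 (0ℚ <? lam i)) (λ i → 𝟙 (inDualCone? a T x i)))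
    where
    factor : ∀ i → φ i (lookup T i) x ≡ (if lookup T i then 1ℚ else - 𝟙 (0ℚ <? lam i)) * 𝟙 (inDualCone? a T x i)
    factor i with lookup T i
    ... | inside = sym (ℚP.*-identityˡ (𝟙 (0ℚ ≤? a i · x)))
    ... | outside = sym (ℚP.*-identityʳ (- 𝟙 (0ℚ <? lam i)))

  ∑ₛ-term≡0 : IsRelation a lam → ∀ j₀ → 0ℚ < lam j₀ → ∀ x → ∑ₛ (λ T → term T x) ≡ 0ℚ
  ∑ₛ-term≡0 rel j₀ 0<lamⱼ₀ x = trans (∑ₛ-∏ (λ i b → φ i b x)) vanish
    where
    factor : Fin (suc n) → ℚ
    factor i = φ i outside x + φ i inside x
    vanish : ∏ factor ≡ 0ℚ
    vanish with any? (λ i → factor i ≟ 0ℚ)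
    ... | yes (i , factorᵢ≡0) = ∏-zero i factor factorᵢ≡0
    ... | no none = ⊥-elim (ℚP.<-irrefl (relation-· a lam rel x)
      (∑-neg _ j₀ (λ i → 𝟙-mismatch⇒*≤0 (0ℚ <? lam i) (0ℚ ≤? a i · x) (λ e → none (i , e)))
                  (𝟙-mismatch⇒*<0 0<lamⱼ₀ (0ℚ <? lam j₀) (0ℚ ≤? a j₀ · x) (λ e → none (j₀ , e)))))

  InL-term : IsRelation a lam → Generates a → (∀ j → 0ℚ < lam j → det (omit j a) ≢ 0ℚ) →
             ∀ T → InL (λ x → 𝟙 (2 ℕP.≤? ∣ ∁ T ∣) * term T x)
  InL-term rel gen D≢0 T = InL-𝟙* (2 ℕP.≤? ∣ ∁ T ∣) InL-term-≥2
    where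
    InL-term-≥2 : 2 ℕ.≤ ∣ ∁ T ∣ → InL (term T)
    InL-term-≥2 2≤∣∁T∣ with any? (λ i → (lookup T i Bool.≟ outside) ×-dec ¬? (0ℚ <? lam i))
    ... | yes (i , i∉T , lamᵢ≯0) = InL-ext (λ x → sym (∏-zero i (λ i → φ i (lookup T i) x)
          (trans (cong (λ b → φ i b x) i∉T) (cong -_ (𝟙-no (0ℚ <? lam i) lamᵢ≯0))))) InL-zero
    ... | no none with two-outside T 2≤∣∁T∣
    ...   | j , k , j≢k , j∉T , k∉T = InL-ext (λ x → sym (term≡coefficient*indicator T x))
            (InL-scale (coefficient T) (DualConeWithLine.InL-dualConeIndicator a lam rel gen j≢k
              (pos⇒≢0 0<lamⱼ) (D≢0 j 0<lamⱼ) T j∉T k∉T))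
      where
      0<lamⱼ : 0ℚ < lam j
      0<lamⱼ with 0ℚ <? lam j
      ... | yes 0<lamⱼ = 0<lamⱼ
      ... | no 0≮lamⱼ = ⊥-elim (none (j , j∉T , 0≮lamⱼ))

positiveFacetSum≡cdual-modL : ∀ {n} (a : Fin (suc n) → Vecℚ n) (lam : Fin (suc n) → ℚ) →
  IsRelation a lam → Generates a → ∀ j₀ → 0ℚ < lam j₀ → (∀ j → 0ℚ < lam j → det (omit j a) ≢ 0ℚ) →
  positiveFacetSum lam a ≡ cdual a modL
positiveFacetSum≡cdual-modL a lam rel gen j₀ 0<lamⱼ₀ D≢0 =
  InL-ext restricted≡ (InL-∑ₛ (λ T x → 𝟙 (2 ℕP.≤? ∣ ∁ T ∣) * term T x) (InL-term rel gen D≢0))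
  where
  open FacetExpansion a lam
  restricted≡ : ∀ x → ∑ₛ≥ 2 (λ T → term T x) ≡ positiveFacetSum lam a x - cdual a x
  restricted≡ x = begin
    S                                    ≡⟨ regroup P C S ⟩
    P - C + (C + (- P + S))              ≡⟨ cong (λ y → P - C + y) expand ⟨
    P - C + (term ⊤ x + (∑ (λ j → term (⊤ [ j ]≔ outside) x) + S))
                                         ≡⟨ cong (λ y → P - C + (term ⊤ x + y)) (∑ₛ≥1≡∑-⊤-j+∑ₛ≥2 (λ T → term T x)) ⟨
    P - C + (term ⊤ x + ∑ₛ≥ 1 (λ T → term T x))
                                         ≡⟨ cong (λ y → P - C + y) (∑ₛ≡⊤+∑ₛ≥1 (λ T → term T x)) ⟨
    P - C + ∑ₛ (λ T → term T x)          ≡⟨ cong (λ y → P - C + y) (∑ₛ-term≡0 rel j₀ 0<lamⱼ₀ x) ⟩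
    P - C + 0ℚ                           ≡⟨ ℚP.+-identityʳ (P - C) ⟩
    P - C                                ∎
    where
    P C S : ℚ
    P = positiveFacetSum lam a x
    C = cdual a x
    S = ∑ₛ≥ 2 (λ T → term T x)
    regroup : ∀ p c s → s ≡ p - c + (c + (- p + s))
    regroup = solve-∀ ℚ-ring
    expand : term ⊤ x + (∑ (λ j → term (⊤ [ j ]≔ outside) x) + S) ≡ C + (- P + S)
    expand = cong₂ (λ y z → y + (z + S)) (term-⊤ x)
      (trans (∑-cong (term-⊤-j x)) (sym (neg-distrib-∑ (λ j → 𝟙 (0ℚ <? lam j) * cdual (omit j a) x))))

-- Signs of the cofactors

module RelationSigns {n} (c : ℚ) (a : Fin (suc n) → Vecℚ n) (lam : Fin (suc n) → ℚ) (rel : IsRelation a lam)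
                     {i₀ : Fin (suc n)} (lamᵢ₀≢0 : lam i₀ ≢ 0ℚ) where

  instance
    lamᵢ₀-nonZero : NonZero (lam i₀)
    lamᵢ₀-nonZero = ≢-nonZero lamᵢ₀≢0

  κ : ℚ
  κ = cofactor a i₀ * 1/ lam i₀

  cofactor≡lam*κ : ∀ j → cofactor a j ≡ lam j * κ
  cofactor≡lam*κ j = begin
    cofactor a j                          ≡⟨ ℚP.*-identityˡ (cofactor a j) ⟨
    1ℚ * cofactor a j                     ≡⟨ cong (_* cofactor a j) (ℚP.*-inverseˡ (lam i₀)) ⟨
    1/ lam i₀ * lam i₀ * cofactor a j     ≡⟨ ℚP.*-assoc (1/ lam i₀) (lam i₀) (cofactor a j) ⟩
    1/ lam i₀ * (lam i₀ * cofactor a j)   ≡⟨ cong (1/ lam i₀ *_) (cofactor-proportional a lam rel i₀ j) ⟩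
    1/ lam i₀ * (lam j * cofactor a i₀)   ≡⟨ lemma (1/ lam i₀) (lam j) (cofactor a i₀) ⟩
    lam j * κ                             ∎
    where
    lemma : ∀ u l e → u * (l * e) ≡ l * (e * u)
    lemma = solve-∀ ℚ-ring

  s : ℚ
  s = sign (c * κ)

  epsilon≡sign*s : ∀ j → epsilon c a j ≡ sign (lam j) * s
  epsilon≡sign*s j = begin
    sgn j * sign (c * det (omit j a))                  ≡⟨ cong (λ d → sgn j * sign (c * d)) det≡ ⟩
    sgn j * sign (c * (sgn j * (lam j * κ)))           ≡⟨ cong (λ y → sgn j * sign y) (lemma c (sgn j) (lam j) κ) ⟩
    sgn j * sign (sgn j * (lam j * (c * κ)))           ≡⟨ cong (sgn j *_) (trans (sign-* (sgn j) _)
                                                            (cong₂ _*_ (sign-sgn j) (sign-* (lam j) (c * κ)))) ⟩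
    sgn j * (sgn j * (sign (lam j) * s))               ≡⟨ ℚP.*-assoc (sgn j) (sgn j) (sign (lam j) * s) ⟨
    sgn j * sgn j * (sign (lam j) * s)                 ≡⟨ cong (_* (sign (lam j) * s)) (sgn²≡1 j) ⟩
    1ℚ * (sign (lam j) * s)                            ≡⟨ ℚP.*-identityˡ (sign (lam j) * s) ⟩
    sign (lam j) * s                                   ∎
    where
    lemma : ∀ c s l k → c * (s * (l * k)) ≡ s * (l * (c * k))
    lemma = solve-∀ ℚ-ring
    det≡ : det (omit j a) ≡ sgn j * (lam j * κ)
    det≡ = begin
      det (omit j a)                 ≡⟨ ℚP.*-identityˡ (det (omit j a)) ⟨
      1ℚ * det (omit j a)            ≡⟨ cong (_* det (omit j a)) (sgn²≡1 j) ⟨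
      sgn j * sgn j * det (omit j a) ≡⟨ ℚP.*-assoc (sgn j) (sgn j) (det (omit j a)) ⟩
      sgn j * cofactor a j           ≡⟨ cong (sgn j *_) (cofactor≡lam*κ j) ⟩
      sgn j * (lam j * κ)            ∎

  det≢0 : s ≢ 0ℚ → ∀ j → lam j ≢ 0ℚ → det (omit j a) ≢ 0ℚ
  det≢0 s≢0 j lamⱼ≢0 detⱼ≡0 = s≢0 (trans (cong (λ y → sign (c * y)) κ≡0) (cong sign (ℚP.*-zeroʳ c)))
    where
    κ≡0 : κ ≡ 0ℚ
    κ≡0 = x*y≡0⇒y≡0 lamⱼ≢0 (trans (sym (cofactor≡lam*κ j)) (trans (cong (sgn j *_) detⱼ≡0) (ℚP.*-zeroʳ (sgn j))))

  coneSum≡ : ∀ x → coneSum c a x ≡ s * ∑ (λ j → sign (lam j) * cdual (omit j a) x)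
  coneSum≡ x = begin
    ∑ (λ j → epsilon c a j * cdual (omit j a) x)          ≡⟨ ∑-cong (λ j → cong (_* cdual (omit j a) x) (epsilon≡sign*s j)) ⟩
    ∑ (λ j → sign (lam j) * s * cdual (omit j a) x)       ≡⟨ ∑-cong (λ j → *-ℚ.xy∙z≈y∙xz (sign (lam j)) s (cdual (omit j a) x)) ⟩
    ∑ (λ j → s * (sign (lam j) * cdual (omit j a) x))     ≡⟨ *-distribˡ-∑ s (λ j → sign (lam j) * cdual (omit j a) x) ⟨
    s * ∑ (λ j → sign (lam j) * cdual (omit j a) x)       ∎

coneSum-positiveRelation : ∀ {n} (c : ℚ) (a : Fin (suc n) → Vecℚ n) → Generates a →
  Σ (Fin (suc n) → ℚ) (λ lam → (∀ j → 0ℚ < lam j) × IsRelation a lam) →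
  Σ ℚ (λ ε → (∀ j → epsilon c a j ≡ ε) × (coneSum c a ≡ (λ v → ε * delta v) modL))
coneSum-positiveRelation c a gen (lam , lam>0 , rel) =
  s , epsilon≡s , InL-ext difference≡ (InL-scale-nonzero s facets-modL)
  where
  open RelationSigns c a lam rel {zero} (pos⇒≢0 (lam>0 zero))
  epsilon≡s : ∀ j → epsilon c a j ≡ s
  epsilon≡s j = trans (epsilon≡sign*s j) (trans (cong (_* s) (sign-pos (lam>0 j))) (ℚP.*-identityˡ s))
  facets-modL : s ≢ 0ℚ → positiveFacetSum lam a ≡ cdual a modL
  facets-modL s≢0 = positiveFacetSum≡cdual-modL a lam rel gen zero (lam>0 zero) (λ j → det≢0 s≢0 j ∘ pos⇒≢0)
  difference≡ : ∀ x → s * (positiveFacetSum lam a x - cdual a x) ≡ coneSum c a x - s * delta x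
  difference≡ x = begin
    s * (positiveFacetSum lam a x - cdual a x)    ≡⟨ lemma s (positiveFacetSum lam a x) (cdual a x) ⟩
    s * positiveFacetSum lam a x - s * cdual a x  ≡⟨ cong₂ (λ p d → s * p - s * d) signs≡ (cdual≡delta a lam rel gen lam>0 x) ⟩
    s * ∑ (λ j → sign (lam j) * cdual (omit j a) x) - s * delta x
                                                  ≡⟨ cong (_- s * delta x) (coneSum≡ x) ⟨
    coneSum c a x - s * delta x                   ∎
    where
    lemma : ∀ s p d → s * (p - d) ≡ s * p - s * d
    lemma = solve-∀ ℚ-ring
    signs≡ : positiveFacetSum lam a x ≡ ∑ (λ j → sign (lam j) * cdual (omit j a) x)
    signs≡ = ∑-cong (λ j → cong (_* cdual (omit j a) x) (trans (𝟙-yes (0ℚ <? lam j) (lam>0 j)) (sym (sign-pos (lam>0 j)))))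

coneSum-mixedRelation : ∀ {n} (c : ℚ) (a : Fin (suc n) → Vecℚ n) → Generates a →
  Σ (Fin (suc n) → ℚ) (λ lam → IsRelation a lam × Σ (Fin (suc n)) (λ j → 0ℚ < lam j) × Σ (Fin (suc n)) (λ k → lam k < 0ℚ)) →
  coneSum c a ≡ (λ v → 0ℚ) modL
coneSum-mixedRelation {n} c a gen (lam , rel , (j₊ , 0<lamⱼ₊) , (j₋ , lamⱼ₋<0)) =
  InL-ext difference≡ (InL-scale-nonzero s facets-modL)
  where
  open RelationSigns c a lam rel (pos⇒≢0 0<lamⱼ₊)
  P₊ P₋ : Vecℚ n → ℚ
  P₊ = positiveFacetSum lam a
  P₋ = positiveFacetSum (λ j → - lam j) a
  facets-modL : s ≢ 0ℚ → InL (λ x → (P₊ x - cdual a x) + (- 1ℚ) * (P₋ x - cdual a x))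
  facets-modL s≢0 = InL-+
    (positiveFacetSum≡cdual-modL a lam rel gen j₊ 0<lamⱼ₊ (λ j → det≢0 s≢0 j ∘ pos⇒≢0))
    (InL-scale (- 1ℚ) (positiveFacetSum≡cdual-modL a (λ j → - lam j) (neg-relation a lam rel) gen
      j₋ (ℚP.neg-antimono-< lamⱼ₋<0) (λ j 0<-lamⱼ → det≢0 s≢0 j (λ lamⱼ≡0 → pos⇒≢0 0<-lamⱼ (cong -_ lamⱼ≡0)))))
  difference≡ : ∀ x → s * ((P₊ x - cdual a x) + (- 1ℚ) * (P₋ x - cdual a x)) ≡ coneSum c a x - 0ℚ
  difference≡ x = begin
    s * ((P₊ x - C) + (- 1ℚ) * (P₋ x - C))  ≡⟨ lemma s (P₊ x) (P₋ x) C ⟩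
    s * (P₊ x + - P₋ x)                     ≡⟨ cong (λ y → s * (P₊ x + y))
                                                 (neg-distrib-∑ (λ j → 𝟙 (0ℚ <? - lam j) * cdual (omit j a) x)) ⟩
    s * (P₊ x + ∑ (λ j → - (𝟙 (0ℚ <? - lam j) * cdual (omit j a) x)))
                                            ≡⟨ cong (s *_) (∑-distrib-+ (λ j → 𝟙 (0ℚ <? lam j) * cdual (omit j a) x)
                                                                        (λ j → - (𝟙 (0ℚ <? - lam j) * cdual (omit j a) x))) ⟨
    s * ∑ (λ j → 𝟙 (0ℚ <? lam j) * cdual (omit j a) x + - (𝟙 (0ℚ <? - lam j) * cdual (omit j a) x))
                                            ≡⟨ cong (s *_) (∑-cong (λ j → signs≡ j)) ⟨
    s * ∑ (λ j → sign (lam j) * cdual (omit j a) x)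
                                            ≡⟨ coneSum≡ x ⟨
    coneSum c a x                           ≡⟨ ℚP.+-identityʳ (coneSum c a x) ⟨
    coneSum c a x - 0ℚ                      ∎
    where
    C : ℚ
    C = cdual a x
    lemma : ∀ s p q c → s * ((p - c) + (- 1ℚ) * (q - c)) ≡ s * (p + - q)
    lemma = solve-∀ ℚ-ring
    signs≡ : ∀ j → sign (lam j) * cdual (omit j a) x
                 ≡ 𝟙 (0ℚ <? lam j) * cdual (omit j a) x + - (𝟙 (0ℚ <? - lam j) * cdual (omit j a) x)
    signs≡ j = trans (cong (_* cdual (omit j a) x) (sign≡𝟙-𝟙 (lam j)))
                     (distrib (𝟙 (0ℚ <? lam j)) (𝟙 (0ℚ <? - lam j)) (cdual (omit j a) x))
      where
      distrib : ∀ p q d → (p - q) * d ≡ p * d + - (q * d)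
      distrib = solve-∀ ℚ-ring

theorem2 : (n : ℕ) → 1 ℕ.≤ n → (c : ℚ) → ¬ (c ≡ 0ℚ) → (a : Fin (suc n) → Vecℚ n)
    → (∀ j → ¬ IsZero (a j)) → Generates a
    → ((Σ (Fin (suc n) → ℚ) (λ lam → (∀ j → 0ℚ < lam j) × IsRelation a lam))
        → Σ ℚ (λ ε → (∀ j → epsilon c a j ≡ ε)
              × (coneSum c a ≡ (λ v → ε * delta v) modL)))
    × ((Σ (Fin (suc n) → ℚ) (λ lam → IsRelation a lam
          × Σ (Fin (suc n)) (λ j → 0ℚ < lam j) × Σ (Fin (suc n)) (λ k → lam k < 0ℚ)))
        → coneSum c a ≡ (λ v → 0ℚ) modL)
theorem2 n _ c _ a _ gen = coneSum-positiveRelation c a gen , coneSum-mixedRelation c a gen
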